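{- Let $A_1,\ldots,A_n$ be the datatypes involved in the functions of $\mathbb F$. Suppose $\mathbb F$ contains some function $\omega:B_1\times\cdots\times B_\ell\to B_i$ (with $1\le i\le\ell$) and some constants $\nu_1\in B_1,\ldots,\nu_\ell\in B_\ell$. Let $\tau:\{1,\ldots,k\}\to\{1,\ldots,n\}$ and $\iota:\{1,\ldots,q\}\to\{1,\ldots,n\}$. Let $(\rho_s)_{s=1,\ldots,p+q}$, $(\varphi_{i,j})_{i=1,\ldots,p,\,j=1,\ldots,k}$, $(\gamma_\ell)_{\ell=1,\ldots,q}$ be good $\mathbb F$-terms with variables $x_i$ for $i$ ranging respectively in sets $I_s, I_{i,j}, J_\ell\subseteq\{1,\ldots,k\}$, such that $[\![\rho_s]\!]=r_s:\prod_{i\in I_s}A_{\tau(i)}\to\mathrm{Bool}$, $[\![\varphi_{i,j}]\!]=f_{i,j}:\prod_{i'\in I_{i,j}}A_{\tau(i')}\to A_{\tau(j)}$, $[\![\gamma_\ell]\!]=g_\ell:\prod_{i\in J_\ell}A_{\tau(i)}\to A_{\iota(\ell)}$. Then there exist constants $K_{\min},L_{\min}$ such that for all $K\ge K_{\min}$ and $L\ge L_{\min}$ there exists a $\lambda$-term $\theta$ such that: 1. using the leftmost reduction strategy, for all $(a_1,\ldots,a_k)\in A_{\tau(1)}\times\cdots\times A_{\tau(k)}$ and $s\in\{1,\ldots,p+q\}$, writing $\vec a_I=(a_j)_{j\in I}$: if $r_s(\vec a_{I_s})=\mathtt{True}$ and $r_t(\vec a_{I_t})=\mathtt{False}$ for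 all $t<s$, then $\theta\,\ulcorner a_1\urcorner\cdots\ulcorner a_k\urcorner\twoheadrightarrow\theta\,\ulcorner f_{s,1}(\vec a_{I_{s,1}})\urcorner\cdots\ulcorner f_{s,k}(\vec a_{I_{s,k}})\urcorner$ if $s\le p$, and $\theta\,\ulcorner a_1\urcorner\cdots\ulcorner a_k\urcorner\twoheadrightarrow\ulcorner g_\ell(\vec a_{J_\ell})\urcorner$ if $s=p+\ell$; 2. in all cases, this sequence of reductions consists of exactly $K$ $\beta$-reductions and $L$ $\mathbb F$-reductions.
   Context: $\mathbb F$ is a family of functions over datatypes $A_1,\ldots,A_n$ (among them $\mathrm{Bool}$), each element $a$ coded by a closed normal $\lambda$-term $\ulcorner a\urcorner$, with $\ulcorner\mathtt{True}\urcorner=\lambda xy.x$, $\ulcorner\mathtt{False}\urcorner=\lambda xy.y$. $\Lambda_{\mathbb F}$-terms are built from variables and constants $c_f$ ($f\in\mathbb F$) by abstraction and application; one-step reduction is $\beta$-reduction or $\mathbb F$-reduction $c_f\ulcorner a_1\urcorner\cdots\ulcorner a_k\urcorner\to\ulcorner f(a_1,\ldots,a_k)\urcorner$, in any subterm; $\twoheadrightarrow$ is the reflexive transitive closure. The leftmost strategy reduces the leftmost $\mathbb F$-redex if any, else the leftmost $\beta$-redex. Good $\mathbb F$-terms: built (from typed variables, then with typed variables replaced injectively by untyped ones) as $c_f\,t_1\cdots t_k$ with $f:A_{i_1}\times\cdots\times A_{i_k}\to A_q$ in $\mathbb F$ and each $t_j$ a variable of type $A_{i_j}$ or a good $\mathbb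 F$-term of value type $A_{i_j}$; the semantics $[\![\cdot]\!]$ is the function of the variables obtained by composing the functions of $\mathbb F$. The variable $x_i$ is of type $A_{\tau(i)}$. -}

module Defs where

open import Data.Nat using (ℕ; zero; suc; _<ᵇ_; _≡ᵇ_; pred; _<_)
open import Data.Bool using (Bool; true; false; if_then_else_)
open import Data.Fin using (Fin)
open import Data.List using (List; []; _∷_; length; lookup; map; foldl)
open import Data.Product using (Σ; _×_; _,_; ∃)
open import Data.Unit using (⊤; tt)
open import Data.Empty using (⊥)
open import Relation.Nullary using (¬_)
open import Relation.Binary.PropositionalEquality using (_≡_; subst; sym)

data Term (C : Set) : Set where
  var : ℕ → Term C
  ƛ_  : Term C → Term C
  _·_ : Term C → Term C → Term C
  con : C → Term C

infixl 7 _·_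

module _ {C : Set} where

  shift : ℕ → Term C → Term C
  shift c (var x) = if x <ᵇ c then var x else var (suc x)
  shift c (ƛ M) = ƛ shift (suc c) M
  shift c (M · N) = shift c M · shift c N
  shift c (con f) = con f

  sub : ℕ → Term C → Term C → Term C
  sub j N (var x) = if x ≡ᵇ j then N else (if x <ᵇ j then var x else var (pred x))
  sub j N (ƛ M) = ƛ sub (suc j) (shift 0 N) M
  sub j N (M · M') = sub j N M · sub j N M'
  sub j N (con f) = con f

  _·⋆_ : Term C → List (Term C) → Term C
  t ·⋆ us = foldl _·_ t us

  data ScopedIn : ℕ → Term C → Set where
    var : ∀ {c x} → x < c → ScopedIn c (var x)
    ƛ_  : ∀ {c M} → ScopedIn (suc c) M → ScopedIn c (ƛ M)
    _·_ : ∀ {c M N} → ScopedIn c M → ScopedIn c N → ScopedIn c (M · N)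
    con : ∀ {c f} → ScopedIn c (con f)

  Closed : Term C → Set
  Closed = ScopedIn 0

  data Pure : Term C → Set where
    var : ∀ {x} → Pure (var x)
    ƛ_  : ∀ {M} → Pure M → Pure (ƛ M)
    _·_ : ∀ {M N} → Pure M → Pure N → Pure (M · N)

  IsLam : Term C → Set
  IsLam (ƛ _) = ⊤
  IsLam _ = ⊥

  data HasBeta : Term C → Set where
    here : ∀ {M N} → HasBeta ((ƛ M) · N)
    appL : ∀ {M N} → HasBeta M → HasBeta (M · N)
    appR : ∀ {M N} → HasBeta N → HasBeta (M · N)
    lam  : ∀ {M} → HasBeta M → HasBeta (ƛ M)

  NormalForm : Term C → Set
  NormalForm t = ¬ HasBeta t

  data _⟶βl_ : Term C → Term C → Set where
    root : ∀ {M N} → ((ƛ M) · N) ⟶βl sub 0 N M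
    appL : ∀ {M M' N} → ¬ IsLam M → M ⟶βl M' → (M · N) ⟶βl (M' · N)
    appR : ∀ {M N N'} → ¬ IsLam M → ¬ HasBeta M → N ⟶βl N' → (M · N) ⟶βl (M · N')
    lam  : ∀ {M M'} → M ⟶βl M' → (ƛ M) ⟶βl (ƛ M')

ArgsOf : ∀ {n} → (Fin n → Set) → List (Fin n) → Set
ArgsOf A [] = ⊤
ArgsOf A (i ∷ is) = A i × ArgsOf A is

record Sig : Set₁ where
  field
    n     : ℕ
    A     : Fin n → Set
    bool  : Fin n
    A-bool : A bool ≡ Bool
    Fsym  : Set
    dom   : Fsym → List (Fin n)
    cod   : Fsym → Fin n
    sem   : (f : Fsym) → ArgsOf A (dom f) → A (cod f)
    code  : (i : Fin n) → A i → Term Fsym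
    code-pure   : ∀ i a → Pure (code i a)
    code-closed : ∀ i a → Closed (code i a)
    code-normal : ∀ i a → NormalForm (code i a)
    code-inj    : ∀ i a b → code i a ≡ code i b → a ≡ b
    code-true   : code bool (subst (λ X → X) (sym A-bool) true) ≡ ƛ ƛ var 1
    code-false  : code bool (subst (λ X → X) (sym A-bool) false) ≡ ƛ ƛ var 0

module WithSig (S : Sig) where
  open Sig S public

  Tm : Set
  Tm = Term Fsym

  Args : List (Fin n) → Set
  Args = ArgsOf A

  codes : ∀ {is} → Args is → List Tm
  codes {[]} tt = []
  codes {i ∷ is} (a , as) = code i a ∷ codes as

  FRedex : Tm → Tm → Set
  FRedex t t' = Σ Fsym λ f → Σ (Args (dom f)) λ as →
                  (t ≡ con f ·⋆ codes as) × (t' ≡ code (cod f) (sem f as))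

  IsFRedex : Tm → Set
  IsFRedex t = ∃ λ t' → FRedex t t'

  data HasF : Tm → Set where
    here : ∀ {t} → IsFRedex t → HasF t
    appL : ∀ {M N} → HasF M → HasF (M · N)
    appR : ∀ {M N} → HasF N → HasF (M · N)
    lam  : ∀ {M} → HasF M → HasF (ƛ M)

  data _⟶Fl_ : Tm → Tm → Set where
    root : ∀ {t t'} → FRedex t t' → t ⟶Fl t'
    appL : ∀ {M M' N} → ¬ IsFRedex (M · N) → M ⟶Fl M' → (M · N) ⟶Fl (M' · N)
    appR : ∀ {M N N'} → ¬ IsFRedex (M · N) → ¬ HasF M → N ⟶Fl N' → (M · N) ⟶Fl (M · N')
    lam  : ∀ {M M'} → M ⟶Fl M' → (ƛ M) ⟶Fl (ƛ M')

  data LRed : ℕ → ℕ → Tm → Tm → Set where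
    done  : ∀ {t} → LRed 0 0 t t
    stepF : ∀ {K L t t' u} → t ⟶Fl t' → LRed K L t' u → LRed K (suc L) t u
    stepβ : ∀ {K L t t' u} → ¬ HasF t → t ⟶βl t' → LRed K L t' u → LRed (suc K) L t u

  mutual
    data Good (k : ℕ) (τ : Fin k → Fin n) : Fin n → Set where
      gapp : (f : Fsym) → GArgs k τ (dom f) → Good k τ (cod f)

    data GArgs (k : ℕ) (τ : Fin k → Fin n) : List (Fin n) → Set where
      []   : GArgs k τ []
      _∷v_ : ∀ {is} (x : Fin k) → GArgs k τ is → GArgs k τ (τ x ∷ is)
      _∷g_ : ∀ {i is} → Good k τ i → GArgs k τ is → GArgs k τ (i ∷ is)

  Env : (k : ℕ) → (Fin k → Fin n) → Set
  Env k τ = (x : Fin k) → A (τ x)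

  mutual
    ⟦_⟧ : ∀ {k τ i} → Good k τ i → Env k τ → A i
    ⟦ gapp f ts ⟧ ρ = sem f (⟦ ts ⟧ₐ ρ)

    ⟦_⟧ₐ : ∀ {k τ is} → GArgs k τ is → Env k τ → Args is
    ⟦ [] ⟧ₐ ρ = tt
    ⟦ x ∷v ts ⟧ₐ ρ = ρ x , ⟦ ts ⟧ₐ ρ
    ⟦ t ∷g ts ⟧ₐ ρ = ⟦ t ⟧ ρ , ⟦ ts ⟧ₐ ρ

  toBool : A bool → Bool
  toBool b = subst (λ X → X) A-bool b

  HasOmega : Set
  HasOmega = Σ Fsym λ ω →
    (Σ (Fin (length (dom ω))) λ i → cod ω ≡ lookup (dom ω) i) ×
    ((j : Fin (length (dom ω))) → Σ Fsym λ ν → (dom ν ≡ []) × (cod ν ≡ lookup (dom ω) j))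

  applyCodes : ∀ {k} {τ : Fin k → Fin n} → Tm → Env k τ → Tm
  applyCodes {zero} θ a = θ
  applyCodes {suc k} {τ} θ a =
    applyCodes {k} {λ x → τ (Fin.suc x)} (θ · code (τ Fin.zero) (a Fin.zero)) (λ x → a (Fin.suc x))

-- θ is a self-application W W. On codes of a⃗, W W first appends the codes of the constants νⱼ,
-- reduces a chosen number of copies of c_ω ⌜ν⃗⌝ (padding by 𝔽-steps) and then runs a
-- straight-line program obtained by flattening the good terms ρ, φ, γ. Each instruction is a
-- combinator whose β-cost depends only on the size of the store, followed by at most one 𝔽-step,
-- so all tests and results are computed at a cost independent of a⃗. The codes ⌜True⌝ = λxy.x and
-- ⌜False⌝ = λxy.y then select the first successful branch, padded with identities so that all
-- branches cost the same; it either restarts W W on the new arguments or returns a code. All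
-- intermediate terms are kept closed, 𝔽-normal and not headed by a constant, which makes each of
-- these steps the one chosen by the leftmost strategy.
module Submission where

open import Defs
open import Data.Bool using (true; false; if_then_else_)
open import Data.Bool.Properties using (T-≡; ¬-not)
open import Data.Empty using (⊥)
open import Data.Fin using (Fin; toℕ; _↑ˡ_; _↑ʳ_; splitAt) renaming (_<_ to _<ᶠ_; zero to fz; suc to fs)
open import Data.Fin.Properties using (splitAt-↑ˡ; splitAt-↑ʳ; toℕ<n)
open import Data.List using (List; []; _∷_; length; map; _++_; _∷ʳ_; tabulate)
import Data.List
open import Data.List.Properties using (foldl-++; length-tabulate; map-++; length-map; length-++; map-∘; map-id; map-cong-local)
open import Data.List.Membership.Propositional using (_∈_)
open import Data.List.Membership.Propositional.Properties using (∈-tabulate⁺)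
open import Data.List.Relation.Unary.All as All using (All; []; _∷_)
open import Data.List.Relation.Unary.All.Properties using (++⁺; map⁺)
open import Data.List.Relation.Unary.Any using (here; there; index)
open import Data.Nat using (ℕ; zero; suc; _+_; _*_; _∸_; _≤_; _<_; z≤n; s≤s; _<ᵇ_; _≡ᵇ_)
open import Data.Nat.Properties
open import Data.Product using (Σ; _×_; _,_; proj₁; proj₂)
open import Data.Sum using ([_,_]′)
open import Data.Unit using (⊤; tt)
open import Function using (_∘_; Equivalence)
open import Relation.Binary.Definitions using (tri<; tri≈; tri>)
open import Relation.Binary.PropositionalEquality
open import Relation.Binary.PropositionalEquality.Properties using (subst-sym-subst)
open import Relation.Nullary using (¬_)

<ᵇ-true : ∀ {x c} → x < c → (x <ᵇ c) ≡ true
<ᵇ-true x<c = Equivalence.to T-≡ (<⇒<ᵇ x<c)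

<ᵇ-false : ∀ {x c} → ¬ x < c → (x <ᵇ c) ≡ false
<ᵇ-false {x} {c} x≮c = ¬-not (λ x<ᵇc → x≮c (<ᵇ⇒< x c (Equivalence.from T-≡ x<ᵇc)))

≡ᵇ-refl : ∀ x → (x ≡ᵇ x) ≡ true
≡ᵇ-refl x = Equivalence.to T-≡ (≡⇒≡ᵇ x x refl)

≡ᵇ-false : ∀ {x y} → x ≢ y → (x ≡ᵇ y) ≡ false
≡ᵇ-false {x} {y} x≢y = ¬-not (λ x≡ᵇy → x≢y (≡ᵇ⇒≡ x y (Equivalence.from T-≡ x≡ᵇy)))

countFrom : ℕ → ℕ → List ℕ
countFrom a zero = []
countFrom a (suc n) = a ∷ countFrom (suc a) n

length-countFrom : ∀ a n → length (countFrom a n) ≡ n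
length-countFrom a zero = refl
length-countFrom a (suc n) = cong suc (length-countFrom (suc a) n)

countFrom-suc : ∀ a n → countFrom a (suc n) ≡ countFrom a n ∷ʳ (a + n)
countFrom-suc a zero = cong (_∷ []) (sym (+-identityʳ a))
countFrom-suc a (suc n) =
  cong (a ∷_) (trans (countFrom-suc (suc a) n) (cong (countFrom (suc a) n ∷ʳ_) (sym (+-suc a n))))

All-countFrom : ∀ {P : ℕ → Set} a n {m} → a + n ≤ m → (∀ {i} → i < m → P i) → All P (countFrom a n)
All-countFrom a zero le h = []
All-countFrom a (suc n) {m} le h =
  h (≤-trans (s≤s (m≤m+n a n)) le′) ∷ All-countFrom (suc a) n le′ h
  where
  le′ : suc a + n ≤ m
  le′ = subst (_≤ m) (+-suc a n) le

module Syntax {C : Set} where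

  ƛ^ : ℕ → Term C → Term C
  ƛ^ zero t = t
  ƛ^ (suc d) t = ƛ ƛ^ d t

  ScopedIn-mono : ∀ {c d} {t : Term C} → c ≤ d → ScopedIn c t → ScopedIn d t
  ScopedIn-mono c≤d (var x<c) = var (≤-trans x<c c≤d)
  ScopedIn-mono c≤d (ƛ s) = ƛ ScopedIn-mono (s≤s c≤d) s
  ScopedIn-mono c≤d (s · s') = ScopedIn-mono c≤d s · ScopedIn-mono c≤d s'
  ScopedIn-mono c≤d con = con

  Closed⇒ScopedIn : ∀ {d} {t : Term C} → Closed t → ScopedIn d t
  Closed⇒ScopedIn = ScopedIn-mono z≤n

  ScopedIn-ƛ^ : ∀ d c {t : Term C} → ScopedIn (d + c) t → ScopedIn c (ƛ^ d t)
  ScopedIn-ƛ^ zero c s = s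
  ScopedIn-ƛ^ (suc d) c {t} s = ƛ ScopedIn-ƛ^ d (suc c) (subst (λ e → ScopedIn e t) (sym (+-suc d c)) s)

  ScopedIn-·⋆ : ∀ {c} (t : Term C) us → ScopedIn c t → All (ScopedIn c) us → ScopedIn c (t ·⋆ us)
  ScopedIn-·⋆ t [] st [] = st
  ScopedIn-·⋆ t (u ∷ us) st (su ∷ sus) = ScopedIn-·⋆ (t · u) us (st · su) sus

  shift-scoped : ∀ {c} {t : Term C} → ScopedIn c t → shift c t ≡ t
  shift-scoped (var x<c) rewrite <ᵇ-true x<c = refl
  shift-scoped (ƛ s) = cong ƛ_ (shift-scoped s)
  shift-scoped (s · s') = cong₂ _·_ (shift-scoped s) (shift-scoped s')
  shift-scoped con = refl

  sub-scoped : ∀ {j} (N : Term C) {t : Term C} → ScopedIn j t → sub j N t ≡ t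
  sub-scoped {j} N (var {x = x} x<j) rewrite ≡ᵇ-false {x} {j} (λ { refl → <-irrefl refl x<j }) | <ᵇ-true x<j = refl
  sub-scoped N (ƛ s) = cong ƛ_ (sub-scoped (shift 0 N) s)
  sub-scoped N (s · s') = cong₂ _·_ (sub-scoped N s) (sub-scoped N s')
  sub-scoped N con = refl

  sub-ƛ^ : ∀ {N : Term C} → Closed N → ∀ j d t → sub j N (ƛ^ d t) ≡ ƛ^ d (sub (d + j) N t)
  sub-ƛ^ cN j zero t = refl
  sub-ƛ^ {N} cN j (suc d) t rewrite shift-scoped {0} cN =
    cong ƛ_ (trans (sub-ƛ^ cN (suc j) d t) (cong (λ i → ƛ^ d (sub i N t)) (+-suc d j)))

  sub-·⋆ : ∀ j N (t : Term C) us → sub j N (t ·⋆ us) ≡ sub j N t ·⋆ map (sub j N) us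
  sub-·⋆ j N t [] = refl
  sub-·⋆ j N t (u ∷ us) = sub-·⋆ j N (t · u) us

  ·⋆-∷ʳ : ∀ (t : Term C) us u → t ·⋆ (us ∷ʳ u) ≡ (t ·⋆ us) · u
  ·⋆-∷ʳ t us u = foldl-++ _·_ t us (u ∷ [])

  head : Term C → Term C
  head (t · u) = head t
  head t = t

  #args : Term C → ℕ
  #args (t · u) = suc (#args t)
  #args t = 0

  AllArgs : (Term C → Set) → Term C → Set
  AllArgs P (t · u) = AllArgs P t × P u
  AllArgs P t = ⊤

  head-·⋆ : ∀ (t : Term C) us → head (t ·⋆ us) ≡ head t
  head-·⋆ t [] = refl
  head-·⋆ t (u ∷ us) = head-·⋆ (t · u) us

  #args-·⋆ : ∀ (t : Term C) us → #args (t ·⋆ us) ≡ #args t + length us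
  #args-·⋆ t [] = sym (+-identityʳ _)
  #args-·⋆ t (u ∷ us) = trans (#args-·⋆ (t · u) us) (sym (+-suc (#args t) (length us)))

  AllArgs-·⋆ : ∀ {P} (t : Term C) us → AllArgs P t → All P us → AllArgs P (t ·⋆ us)
  AllArgs-·⋆ t [] a [] = a
  AllArgs-·⋆ t (u ∷ us) a (p ∷ ps) = AllArgs-·⋆ (t · u) us (a , p) ps

  -- Total indexing; the junk value for an index out of range is never reached below.
  _‼_ : List (Term C) → ℕ → Term C
  [] ‼ i = ƛ var 0
  (u ∷ us) ‼ zero = u
  (u ∷ us) ‼ suc i = us ‼ i

  map-‼-∷ : ∀ u us a n → map ((u ∷ us) ‼_) (countFrom (suc a) n) ≡ map (us ‼_) (countFrom a n)
  map-‼-∷ u us a zero = refl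
  map-‼-∷ u us a (suc n) = cong (us ‼ a ∷_) (map-‼-∷ u us (suc a) n)

  map-‼-++ˡ : ∀ us vs → map ((us ++ vs) ‼_) (countFrom 0 (length us)) ≡ us
  map-‼-++ˡ [] vs = refl
  map-‼-++ˡ (u ∷ us) vs = cong (u ∷_) (trans (map-‼-∷ u (us ++ vs) 0 (length us)) (map-‼-++ˡ us vs))

  map-‼-countFrom : ∀ us {n} → length us ≡ n → map (us ‼_) (countFrom 0 n) ≡ us
  map-‼-countFrom [] refl = refl
  map-‼-countFrom (u ∷ us) refl = cong (u ∷_) (trans (map-‼-∷ u us 0 (length us)) (map-‼-countFrom us refl))

  map-‼-++ʳ : ∀ us vs a n → map ((us ++ vs) ‼_) (countFrom (length us + a) n) ≡ map (vs ‼_) (countFrom a n)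
  map-‼-++ʳ [] vs a n = refl
  map-‼-++ʳ (u ∷ us) vs a n = trans (map-‼-∷ u (us ++ vs) (length us + a) n) (map-‼-++ʳ us vs a n)

  ‼-++ʳ : ∀ us vs a → (us ++ vs) ‼ (length us + a) ≡ vs ‼ a
  ‼-++ʳ [] vs a = refl
  ‼-++ʳ (u ∷ us) vs a = ‼-++ʳ us vs a

  All-‼ : ∀ {P : Term C → Set} {us} → All P us → ∀ {i} → i < length us → P (us ‼ i)
  All-‼ (p ∷ ps) {zero} _ = p
  All-‼ (p ∷ ps) {suc i} (s≤s lt) = All-‼ ps lt

open Syntax

module Leftmost (S : Sig) where
  open WithSig S

  LRed-trans : ∀ {K₁ L₁ K₂ L₂ t u v} → LRed K₁ L₁ t u → LRed K₂ L₂ u v → LRed (K₁ + K₂) (L₁ + L₂) t v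
  LRed-trans done r = r
  LRed-trans (stepF s r) r' = stepF s (LRed-trans r r')
  LRed-trans (stepβ nf s r) r' = stepβ nf s (LRed-trans r r')

  LRed-cast : ∀ {K L K' L' t u u'} → K ≡ K' → L ≡ L' → u ≡ u' → LRed K L t u → LRed K' L' t u'
  LRed-cast refl refl refl r = r

  FNormal : Tm → Set
  FNormal t = ¬ HasF t

  NonConHead : Tm → Set
  NonConHead t = ∀ f → head t ≢ con f

  record Inert (t : Tm) : Set where
    field
      closed : Closed t
      fnormal : FNormal t
      nonConHead : NonConHead t
  open Inert public

  codes-closed : ∀ {is} (as : Args is) → All Closed (codes as)
  codes-closed {[]} tt = []
  codes-closed {i ∷ is} (a , as) = code-closed i a ∷ codes-closed as

  length-codes : ∀ {is} (as : Args is) → length (codes as) ≡ length is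
  length-codes {[]} tt = refl
  length-codes {i ∷ is} (a , as) = cong suc (length-codes as)

  con-injective : ∀ {f g : Fsym} → _≡_ {A = Tm} (con f) (con g) → f ≡ g
  con-injective refl = refl

  FRedex-shape : ∀ {t} → IsFRedex t →
    Σ Fsym λ f → head t ≡ con f × #args t ≡ length (dom f) × AllArgs Closed t
  FRedex-shape (_ , f , as , refl , _) =
    f , head-·⋆ (con f) (codes as) , trans (#args-·⋆ (con f) (codes as)) (length-codes as) ,
    AllArgs-·⋆ (con f) (codes as) tt (codes-closed as)

  NonConHead⇒¬FRedex : ∀ {t} → NonConHead t → ¬ IsFRedex t
  NonConHead⇒¬FRedex nch r with FRedex-shape r
  ... | f , h , _ = nch f h

  open⇒¬FRedex : ∀ {t u} → ¬ Closed u → ¬ IsFRedex (t · u)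
  open⇒¬FRedex ¬cu r with FRedex-shape r
  ... | _ , _ , _ , (_ , cu) = ¬cu cu

  var-open : ∀ {x} → ¬ Closed {Fsym} (var x)
  var-open (var ())

  ƛ-nonConHead : ∀ {t} → NonConHead (ƛ t)
  ƛ-nonConHead f ()

  ¬FRedex-ƛ· : ∀ {t u} → ¬ IsFRedex ((ƛ t) · u)
  ¬FRedex-ƛ· = NonConHead⇒¬FRedex ƛ-nonConHead

  Pure⇒NonConHead : ∀ {t : Tm} → Pure t → NonConHead t
  Pure⇒NonConHead var f ()
  Pure⇒NonConHead (ƛ p) f ()
  Pure⇒NonConHead (p · p') f e = Pure⇒NonConHead p f e

  Pure⇒FNormal : ∀ {t : Tm} → Pure t → FNormal t
  Pure⇒FNormal p (here r) = NonConHead⇒¬FRedex (Pure⇒NonConHead p) r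
  Pure⇒FNormal (p · p') (appL h) = Pure⇒FNormal p h
  Pure⇒FNormal (p · p') (appR h) = Pure⇒FNormal p' h
  Pure⇒FNormal (ƛ p) (lam h) = Pure⇒FNormal p h

  FNormal-var : ∀ {x} → FNormal (var x)
  FNormal-var (here r) = NonConHead⇒¬FRedex (λ f ()) r

  FNormal-ƛ : ∀ {t} → FNormal t → FNormal (ƛ t)
  FNormal-ƛ h (here r) = NonConHead⇒¬FRedex ƛ-nonConHead r
  FNormal-ƛ h (lam x) = h x

  FNormal-ƛ^ : ∀ d {t} → FNormal t → FNormal (ƛ^ d t)
  FNormal-ƛ^ zero h = h
  FNormal-ƛ^ (suc d) h = FNormal-ƛ (FNormal-ƛ^ d h)

  FNormal-· : ∀ {t u} → FNormal t → FNormal u → ¬ IsFRedex (t · u) → FNormal (t · u)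
  FNormal-· nt nu nr (here r) = nr r
  FNormal-· nt nu nr (appL x) = nt x
  FNormal-· nt nu nr (appR x) = nu x

  FNormal-ƛ· : ∀ {t u} → FNormal t → FNormal u → FNormal ((ƛ t) · u)
  FNormal-ƛ· nt nu = FNormal-· (FNormal-ƛ nt) nu ¬FRedex-ƛ·

  FNormal-ƛ·· : ∀ {t u v} → FNormal t → FNormal u → FNormal v → FNormal (((ƛ t) · u) · v)
  FNormal-ƛ·· nt nu nv = FNormal-· (FNormal-ƛ· nt nu) nv (NonConHead⇒¬FRedex ƛ-nonConHead)

  FNormal-·⋆ : ∀ (t : Tm) us → FNormal t → NonConHead t → All FNormal us → FNormal (t ·⋆ us)
  FNormal-·⋆ t [] nt _ [] = nt
  FNormal-·⋆ t (u ∷ us) nt nch (nu ∷ nus) =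
    FNormal-·⋆ (t · u) us (FNormal-· nt nu (NonConHead⇒¬FRedex nch)) nch nus

  FNormal-con-·⋆ : ∀ f (t : Tm) us → FNormal t → head t ≡ con f → #args t + length us < length (dom f) →
                   All FNormal us → FNormal (t ·⋆ us)
  FNormal-con-·⋆ f t [] nt _ _ [] = nt
  FNormal-con-·⋆ f t (u ∷ us) nt ht lt (nu ∷ nus) =
    FNormal-con-·⋆ f (t · u) us (FNormal-· nt nu ¬redex) ht lt′ nus
    where
    lt′ : suc (#args t) + length us < length (dom f)
    lt′ = subst (_< length (dom f)) (+-suc (#args t) (length us)) lt
    ¬redex : ¬ IsFRedex (t · u)
    ¬redex r with FRedex-shape r
    ... | g , hg , ng , _ with con-injective (trans (sym ht) hg)
    ... | refl = <-irrefl ng (≤-trans (s≤s (s≤s (m≤m+n (#args t) (length us)))) lt′)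

  FNormal-con : ∀ f → 0 < length (dom f) → FNormal (con f)
  FNormal-con f lt (here r) with FRedex-shape r
  ... | g , refl , ng , _ = <-irrefl ng lt

  code-Inert : ∀ i a → Inert (code i a)
  code-Inert i a = record
    { closed = code-closed i a ; fnormal = Pure⇒FNormal (code-pure i a) ; nonConHead = Pure⇒NonConHead (code-pure i a) }

  codes-Inert : ∀ {is} (as : Args is) → All Inert (codes as)
  codes-Inert {[]} tt = []
  codes-Inert {i ∷ is} (a , as) = code-Inert i a ∷ codes-Inert as

  Inert-·⋆ : ∀ (t : Tm) us → Inert t → All Inert us → Inert (t ·⋆ us)
  Inert-·⋆ t us it ius = record
    { closed = ScopedIn-·⋆ t us (closed it) (All.map closed ius)
    ; fnormal = FNormal-·⋆ t us (fnormal it) (nonConHead it) (All.map fnormal ius)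
    ; nonConHead = λ f e → nonConHead it f (trans (sym (head-·⋆ t us)) e)
    }

  ⟶βl-·⋆ : ∀ {t t' : Tm} us → t ⟶βl t' → ¬ IsLam t → (t ·⋆ us) ⟶βl (t' ·⋆ us)
  ⟶βl-·⋆ [] s nl = s
  ⟶βl-·⋆ (u ∷ us) s nl = ⟶βl-·⋆ us (appL nl s) (λ ())

  ⟶Fl-·⋆ : ∀ {t t' : Tm} us → t ⟶Fl t' → NonConHead t → (t ·⋆ us) ⟶Fl (t' ·⋆ us)
  ⟶Fl-·⋆ [] s nch = s
  ⟶Fl-·⋆ (u ∷ us) s nch = ⟶Fl-·⋆ us (appL (NonConHead⇒¬FRedex nch) s) nch

module Combinators (S : Sig) where
  open WithSig S
  open Leftmost S

  -- Bodies of combinators: `par i` is the i-th parameter, `capp f is l` is c_f applied to the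
  -- parameters `is` and then to `l`, which must be the last parameter: it is only substituted
  -- by the last β-step, so no 𝔽-redex exists before the combinator is fully applied.
  infixl 7 _$_
  data Tpl : Set where
    par  : ℕ → Tpl
    cst  : Tm → Tpl
    _$_  : Tpl → Tpl → Tpl
    capp : Fsym → List ℕ → ℕ → Tpl

  inst : (ℕ → Tm) → Tpl → Tm
  inst σ (par i) = σ i
  inst σ (cst t) = t
  inst σ (T $ U) = inst σ T · inst σ U
  inst σ (capp f is l) = (con f ·⋆ map σ is) · σ l

  NonCappHead : Tpl → Set
  NonCappHead (T $ _) = NonCappHead T
  NonCappHead (capp _ _ _) = ⊥
  NonCappHead _ = ⊤

  data Safe (m : ℕ) : Tpl → Set where
    par  : ∀ {i} → i < m → Safe m (par i)
    cst  : ∀ {t} → Inert t → Safe m (cst t)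
    app  : ∀ {T U} → NonCappHead T → Safe m T → Safe m U → Safe m (T $ U)
    capp : ∀ {f is l} → All (_< m) is → suc (length is) ≡ length (dom f) → suc l ≡ m → Safe m (capp f is l)

  _$⋆_ : Tpl → List Tpl → Tpl
  T $⋆ [] = T
  T $⋆ (U ∷ Us) = (T $ U) $⋆ Us

  inst-$⋆ : ∀ σ T Us → inst σ (T $⋆ Us) ≡ inst σ T ·⋆ map (inst σ) Us
  inst-$⋆ σ T [] = refl
  inst-$⋆ σ T (U ∷ Us) = inst-$⋆ σ (T $ U) Us

  Safe-$⋆ : ∀ {m} T Us → NonCappHead T → Safe m T → All (Safe m) Us → Safe m (T $⋆ Us)
  Safe-$⋆ T [] hT sT [] = sT
  Safe-$⋆ T (U ∷ Us) hT sT (sU ∷ sUs) = Safe-$⋆ (T $ U) Us hT (app hT sT sU) sUs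

  inst-cong : ∀ {m} {σ σ' : ℕ → Tm} {T} → Safe m T → (∀ {i} → i < m → σ i ≡ σ' i) → inst σ T ≡ inst σ' T
  inst-cong (par i<m) eq = eq i<m
  inst-cong (cst _) eq = refl
  inst-cong (app _ sT sU) eq = cong₂ _·_ (inst-cong sT eq) (inst-cong sU eq)
  inst-cong (capp {f = f} is<m _ refl) eq =
    cong₂ (λ us u → (con f ·⋆ us) · u) (map-cong-local (All.map eq is<m)) (eq ≤-refl)

  sub-inst : ∀ {m} j N {σ T} → Safe m T → sub j N (inst σ T) ≡ inst (sub j N ∘ σ) T
  sub-inst j N (par _) = refl
  sub-inst j N (cst it) = sub-scoped N (Closed⇒ScopedIn (closed it))
  sub-inst j N (app _ sT sU) = cong₂ _·_ (sub-inst j N sT) (sub-inst j N sU)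
  sub-inst j N {σ} (capp {f = f} {is} _ _ _) =
    cong (_· sub j N (σ _)) (trans (sub-·⋆ j N (con f) (map σ is)) (cong (con f ·⋆_) (sym (map-∘ is))))

  inst-nonConHead : ∀ {m σ T} → NonCappHead T → Safe m T → (∀ {i} → i < m → NonConHead (σ i)) →
                    NonConHead (inst σ T)
  inst-nonConHead _ (par i<m) h = h i<m
  inst-nonConHead _ (cst it) h = nonConHead it
  inst-nonConHead hT (app _ sT sU) h = inst-nonConHead hT sT h

  inst-FNormal : ∀ {m σ T} → Safe m T → (∀ {i} → i < m → FNormal (σ i) × NonConHead (σ i)) →
                 (∀ {l} → suc l ≡ m → ¬ Closed (σ l)) → FNormal (inst σ T)
  inst-FNormal (par i<m) h o = proj₁ (h i<m)
  inst-FNormal (cst it) h o = fnormal it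
  inst-FNormal (app hT sT sU) h o =
    FNormal-· (inst-FNormal sT h o) (inst-FNormal sU h o)
              (NonConHead⇒¬FRedex (inst-nonConHead hT sT (proj₂ ∘ h)))
  inst-FNormal {m} {σ} (capp {f = f} {is} {l} is<m arity refl) h o =
    FNormal-· (FNormal-con-·⋆ f (con f) (map σ is) (FNormal-con f (subst (0 <_) arity (s≤s z≤n))) refl
                 (subst (_< length (dom f)) (sym (length-map σ is)) (subst (length is <_) arity ≤-refl))
                 (map⁺ (All.map (proj₁ ∘ h) is<m)))
              (proj₁ (h ≤-refl))
              (open⇒¬FRedex (o refl))

  inst-ScopedIn : ∀ {m σ T} → Safe m T → (∀ {i} → i < m → ScopedIn m (σ i)) → ScopedIn m (inst σ T)
  inst-ScopedIn (par i<m) h = h i<m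
  inst-ScopedIn (cst it) h = Closed⇒ScopedIn (closed it)
  inst-ScopedIn (app _ sT sU) h = inst-ScopedIn sT h · inst-ScopedIn sU h
  inst-ScopedIn {σ = σ} (capp {f = f} {is} is<m _ refl) h =
    ScopedIn-·⋆ (con f) (map σ is) con (map⁺ (All.map h is<m)) · h ≤-refl

  -- After j of the m β-steps of a combinator, the parameters i < j have been replaced by their
  -- arguments, while parameter i ≥ j is still the de Bruijn index m-1-i under the remaining binders.
  staged : (ℕ → Tm) → ℕ → ℕ → ℕ → Tm
  staged σ m j i = if i <ᵇ j then σ i else var (m ∸ suc i)

  staged-step : ∀ (σ : ℕ → Tm) m j → j < m → (∀ {i} → i < m → Closed (σ i)) →
                ∀ {i} → i < m → sub (m ∸ suc j) (σ j) (staged σ m j i) ≡ staged σ m (suc j) i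
  staged-step σ m j j<m cσ {i} i<m with <-cmp i j
  ... | tri< i<j _ _ rewrite <ᵇ-true i<j | <ᵇ-true (≤-trans i<j (n≤1+n j)) =
    sub-scoped (σ j) (Closed⇒ScopedIn (cσ i<m))
  ... | tri≈ _ refl _ rewrite <ᵇ-false (<-irrefl {i} refl) | ≡ᵇ-refl (m ∸ suc i) | <ᵇ-true (≤-refl {suc i}) = refl
  ... | tri> _ _ j<i rewrite <ᵇ-false (<-asym j<i) | <ᵇ-false (λ i<1+j → <-irrefl refl (≤-trans (s≤s j<i) i<1+j))
                           | ≡ᵇ-false (<⇒≢ (∸-monoʳ-< (s≤s j<i) i<m)) | <ᵇ-true (∸-monoʳ-< (s≤s j<i) i<m) = refl

  staged-all : ∀ σ m {T} → Safe m T → inst (staged σ m m) T ≡ inst σ T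
  staged-all σ m sT = inst-cong sT (λ {i} i<m → cong (if_then σ i else var (m ∸ suc i)) (<ᵇ-true i<m))

  comb : ℕ → Tpl → Tm
  comb m T = ƛ^ m (inst (staged (λ _ → var 0) m 0) T)

  comb-Inert : ∀ m T → 0 < m → Safe m T → Inert (comb m T)
  comb-Inert m@(suc _) T _ sT = record
    { closed = ScopedIn-ƛ^ m 0 (subst (λ c → ScopedIn c (inst (staged (λ _ → var 0) m 0) T)) (sym (+-identityʳ m))
                 (inst-ScopedIn sT (λ i<m → var (∸-monoʳ-< {m} {suc _} {0} (s≤s z≤n) i<m))))
    ; fnormal = FNormal-ƛ^ m (inst-FNormal sT (λ _ → FNormal-var , (λ f ())) (λ _ → var-open))
    ; nonConHead = λ f ()
    }

  private
    staged-FNormal : ∀ σ m j → (∀ {i} → i < m → Inert (σ i)) →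
                     ∀ {i} → i < m → FNormal (staged σ m j i) × NonConHead (staged σ m j i)
    staged-FNormal σ m j iσ {i} i<m with i <ᵇ j
    ... | true = fnormal (iσ i<m) , nonConHead (iσ i<m)
    ... | false = FNormal-var , (λ f ())

    staged-last-open : ∀ σ m j → j < m → ∀ {l} → suc l ≡ m → ¬ Closed (staged σ m j l)
    staged-last-open σ m j j<m {l} refl rewrite <ᵇ-false {l} {j} (λ l<j → <-irrefl refl (≤-trans (s≤s l<j) j<m)) = var-open

    comb-steps : ∀ m T σ → Safe m T → (∀ {i} → i < m → Inert (σ i)) →
                 ∀ d j → j + d ≡ m →
                 LRed d 0 (ƛ^ d (inst (staged σ m j) T) ·⋆ map σ (countFrom j d)) (inst (staged σ m m) T)
    comb-steps m T σ sT iσ zero j e rewrite +-identityʳ j | e = done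
    comb-steps m T σ sT iσ (suc d) j e =
      stepβ fnormal-redex (⟶βl-·⋆ (map σ (countFrom (suc j) d)) root (λ ()))
        (subst (λ t → LRed d 0 (t ·⋆ map σ (countFrom (suc j) d)) (inst (staged σ m m) T)) (sym contract)
          (comb-steps m T σ sT iσ d (suc j) (trans (sym (+-suc j d)) e)))
      where
      j<m : j < m
      j<m = subst (j <_) e (m<m+n j (s≤s z≤n))
      m-j : m ∸ suc j ≡ d
      m-j = trans (cong (_∸ suc j) (trans (sym e) (+-suc j d))) (m+n∸m≡n (suc j) d)
      contract : sub 0 (σ j) (ƛ^ d (inst (staged σ m j) T)) ≡ ƛ^ d (inst (staged σ m (suc j)) T)
      contract = begin
        sub 0 (σ j) (ƛ^ d (inst (staged σ m j) T))             ≡⟨ sub-ƛ^ (closed (iσ j<m)) 0 d _ ⟩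
        ƛ^ d (sub (d + 0) (σ j) (inst (staged σ m j) T))
          ≡⟨ cong (λ x → ƛ^ d (sub x (σ j) (inst (staged σ m j) T))) (trans (+-identityʳ d) (sym m-j)) ⟩
        ƛ^ d (sub (m ∸ suc j) (σ j) (inst (staged σ m j) T))   ≡⟨ cong (ƛ^ d) (sub-inst (m ∸ suc j) (σ j) sT) ⟩
        ƛ^ d (inst (sub (m ∸ suc j) (σ j) ∘ staged σ m j) T)
          ≡⟨ cong (ƛ^ d) (inst-cong sT (staged-step σ m j j<m (closed ∘ iσ))) ⟩
        ƛ^ d (inst (staged σ m (suc j)) T)                     ∎
        where open ≡-Reasoning
      fnormal-redex : FNormal (ƛ^ (suc d) (inst (staged σ m j) T) ·⋆ map σ (countFrom j (suc d)))
      fnormal-redex =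
        FNormal-·⋆ _ (map σ (countFrom j (suc d)))
          (FNormal-ƛ^ (suc d) (inst-FNormal sT (staged-FNormal σ m j iσ) (staged-last-open σ m j j<m))) (λ f ())
          (map⁺ (All-countFrom j (suc d) (≤-reflexive e) (fnormal ∘ iσ)))

  comb-run : ∀ m T (us : List Tm) → length us ≡ m → Safe m T → All Inert us →
             LRed m 0 (comb m T ·⋆ us) (inst (us ‼_) T)
  comb-run m T us refl sT ius =
    LRed-cast refl refl (staged-all (us ‼_) m sT)
      (subst (λ vs → LRed m 0 (comb m T ·⋆ vs) (inst (staged (us ‼_) m m) T)) (map-‼-countFrom us refl)
        (comb-steps m T (us ‼_) sT (All-‼ ius) m 0 refl))

module Semantics (S : Sig) where
  open WithSig S

  mutual
    ⟦⟧-cong : ∀ {k τ i} (t : Good k τ i) {a a' : Env k τ} → (∀ x → a x ≡ a' x) → ⟦ t ⟧ a ≡ ⟦ t ⟧ a'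
    ⟦⟧-cong (gapp f ts) eq = cong (sem f) (⟦⟧ₐ-cong ts eq)

    ⟦⟧ₐ-cong : ∀ {k τ is} (ts : GArgs k τ is) {a a' : Env k τ} → (∀ x → a x ≡ a' x) → ⟦ ts ⟧ₐ a ≡ ⟦ ts ⟧ₐ a'
    ⟦⟧ₐ-cong [] eq = refl
    ⟦⟧ₐ-cong (x ∷v ts) eq = cong₂ _,_ (eq x) (⟦⟧ₐ-cong ts eq)
    ⟦⟧ₐ-cong (t ∷g ts) eq = cong₂ _,_ (⟦⟧-cong t eq) (⟦⟧ₐ-cong ts eq)

module Stores (S : Sig) where
  open WithSig S
  open Leftmost S

  Store : Set
  Store = List (Fin n)

  lookupᵃ : ∀ {Γ : Store} {i} → Args Γ → i ∈ Γ → A i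
  lookupᵃ (v , vs) (here refl) = v
  lookupᵃ (v , vs) (there x) = lookupᵃ vs x

  pos : ∀ {Γ : Store} {i} → i ∈ Γ → ℕ
  pos x = toℕ (index x)

  pos-< : ∀ {Γ : Store} {i} (x : i ∈ Γ) → pos x < length Γ
  pos-< x = toℕ<n (index x)

  ‼-codes : ∀ {Γ : Store} {i} (vs : Args Γ) (x : i ∈ Γ) → codes vs ‼ pos x ≡ code i (lookupᵃ vs x)
  ‼-codes (v , vs) (here refl) = refl
  ‼-codes (v , vs) (there x) = ‼-codes vs x

  selectᵃ : ∀ {Γ : Store} {is} → Args Γ → All (_∈ Γ) is → Args is
  selectᵃ vs [] = tt
  selectᵃ vs (x ∷ xs) = lookupᵃ vs x , selectᵃ vs xs

  ‼-codes-select : ∀ {Γ : Store} {is} (vs : Args Γ) (xs : All (_∈ Γ) is) →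
                   map (codes vs ‼_) (All.reduce pos xs) ≡ codes (selectᵃ vs xs)
  ‼-codes-select vs [] = refl
  ‼-codes-select vs (x ∷ xs) = cong₂ _∷_ (‼-codes vs x) (‼-codes-select vs xs)

  pos-<-all : ∀ {Γ : Store} {is} (xs : All (_∈ Γ) is) → All (_< length Γ) (All.reduce pos xs)
  pos-<-all [] = []
  pos-<-all (x ∷ xs) = pos-< x ∷ pos-<-all xs

  data _⊒_ : Store → Store → Set where
    ⊒-refl : ∀ {Γ} → Γ ⊒ Γ
    ⊒-push : ∀ {i Γ' Γ} → Γ' ⊒ Γ → (i ∷ Γ') ⊒ Γ

  wk : ∀ {Γ' Γ i} → Γ' ⊒ Γ → i ∈ Γ → i ∈ Γ'
  wk ⊒-refl x = x
  wk (⊒-push e) x = there (wk e x)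

  _∘⊒_ : ∀ {Γ'' Γ' Γ} → Γ'' ⊒ Γ' → Γ' ⊒ Γ → Γ'' ⊒ Γ
  ⊒-refl ∘⊒ e = e
  ⊒-push e' ∘⊒ e = ⊒-push (e' ∘⊒ e)

  wk-∘ : ∀ {Γ'' Γ' Γ i} (e' : Γ'' ⊒ Γ') (e : Γ' ⊒ Γ) (x : i ∈ Γ) → wk (e' ∘⊒ e) x ≡ wk e' (wk e x)
  wk-∘ ⊒-refl e x = refl
  wk-∘ (⊒-push e') e x = cong there (wk-∘ e' e x)

  record Extends {Γ' Γ} (e : Γ' ⊒ Γ) (vs' : Args Γ') (vs : Args Γ) : Set where
    constructor mkExtends
    field lookup-wk : ∀ {i} (x : i ∈ Γ) → lookupᵃ vs' (wk e x) ≡ lookupᵃ vs x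
  open Extends public

  Extends-refl : ∀ {Γ} (vs : Args Γ) → Extends ⊒-refl vs vs
  Extends-refl vs = mkExtends (λ x → refl)

  Extends-push : ∀ {Γ : Store} {i} (v : A i) (vs : Args Γ) → Extends (⊒-push ⊒-refl) (v , vs) vs
  Extends-push v vs = mkExtends (λ x → refl)

  Extends-∘ : ∀ {Γ'' Γ' Γ} {e' : Γ'' ⊒ Γ'} {e : Γ' ⊒ Γ} {vs'' vs' vs} →
              Extends e' vs'' vs' → Extends e vs' vs → Extends (e' ∘⊒ e) vs'' vs
  Extends-∘ {e' = e'} {e} {vs''} x y =
    mkExtends (λ v → trans (cong (lookupᵃ vs'') (wk-∘ e' e v)) (trans (lookup-wk x (wk e v)) (lookup-wk y v)))

  envArgs : ∀ {k} {τ : Fin k → Fin n} → Env k τ → Args (tabulate τ)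
  envArgs {zero} a = tt
  envArgs {suc k} a = a fz , envArgs (a ∘ fs)

  lookup-envArgs : ∀ {k} {τ : Fin k → Fin n} (a : Env k τ) x → lookupᵃ (envArgs a) (∈-tabulate⁺ x) ≡ a x
  lookup-envArgs a fz = refl
  lookup-envArgs a (fs x) = lookup-envArgs (a ∘ fs) x

  envArgs-cong : ∀ {k} {τ : Fin k → Fin n} {a a' : Env k τ} → (∀ x → a x ≡ a' x) → envArgs a ≡ envArgs a'
  envArgs-cong {zero} eq = refl
  envArgs-cong {suc k} eq = cong₂ _,_ (eq fz) (envArgs-cong (eq ∘ fs))

  applyCodes-·⋆ : ∀ {k} {τ : Fin k → Fin n} (θ : Tm) (a : Env k τ) → applyCodes θ a ≡ θ ·⋆ codes (envArgs a)
  applyCodes-·⋆ {zero} θ a = refl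
  applyCodes-·⋆ {suc k} θ a = applyCodes-·⋆ _ (a ∘ fs)

-- Straight-line programs over a typed store: each instruction pushes the value of a function of 𝔽
-- on earlier entries. `halt` names N Boolean tests and N outcomes; the compiled λ-term continues
-- with the first outcome whose test is true.
module Programs (S : Sig) (k : ℕ) (τ : Fin k → Fin (Sig.n S)) (N : ℕ) where
  open WithSig S
  open Semantics S
  open Stores S

  data Out (Γ : Store) : Set where
    recurse : ((j : Fin k) → τ j ∈ Γ) → Out Γ
    return  : ∀ i → i ∈ Γ → Out Γ

  data Prog : Store → Set where
    konst : ∀ {Γ} f → dom f ≡ [] → Prog (cod f ∷ Γ) → Prog Γ
    call  : ∀ {Γ} f r → length (dom f) ≡ suc r → All (_∈ Γ) (dom f) → Prog (cod f ∷ Γ) → Prog Γ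
    halt  : ∀ {Γ} → (Fin N → bool ∈ Γ) → (Fin N → Out Γ) → Prog Γ

  konstVal : ∀ f → dom f ≡ [] → A (cod f)
  konstVal f e = sem f (subst Args (sym e) tt)

  record Halted : Set where
    constructor halted
    field
      {store} : Store
      tests   : Fin N → bool ∈ store
      outs    : Fin N → Out store
      values  : Args store

  exec : ∀ {Γ} → Prog Γ → Args Γ → Halted
  exec (konst f e P) vs = exec P (konstVal f e , vs)
  exec (call f r e xs P) vs = exec P (sem f (selectᵃ vs xs) , vs)
  exec (halt b o) vs = halted b o vs

  -- β- and 𝔽-steps taken by the combinators that `Compiled.combP` builds from a program.
  costβ : ∀ {Γ} → Prog Γ → ℕ
  costβ {Γ} (konst f e P) = suc (length Γ) + costβ P
  costβ {Γ} (call f r e xs P) = suc (length Γ) + ((suc (length Γ) + suc r) + costβ P)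
  costβ {Γ} (halt b o) = suc (length Γ)

  costF : ∀ {Γ} → Prog Γ → ℕ
  costF (konst f e P) = costF P
  costF (call f r e xs P) = suc (costF P)
  costF (halt b o) = 0

  Post : Set₁
  Post = Halted → Set

  -- Nullary functions are precomputed: a lone constant c_f would itself be an 𝔽-redex.
  instrOf : ∀ {Γ} f is → dom f ≡ is → All (_∈ Γ) (dom f) → Prog (cod f ∷ Γ) → Prog Γ
  instrOf f [] e xs P = konst f e P
  instrOf f (i ∷ is) e xs P = call f (length is) (cong length e) xs P

  instr : ∀ {Γ} f → All (_∈ Γ) (dom f) → Prog (cod f ∷ Γ) → Prog Γ
  instr f = instrOf f (dom f) refl

  exec-instr : ∀ {Γ} f (xs : All (_∈ Γ) (dom f)) (P : Prog (cod f ∷ Γ)) (vs : Args Γ) (Q : Post) →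
               Q (exec P (sem f (selectᵃ vs xs) , vs)) → Q (exec (instr f xs P) vs)
  exec-instr f xs P vs Q h = go (dom f) refl
    where
    nullary-args : ∀ {is} (e : is ≡ []) (as : Args is) → as ≡ subst Args (sym e) tt
    nullary-args refl tt = refl
    go : ∀ is (e : dom f ≡ is) → Q (exec (instrOf f is e xs P) vs)
    go [] e = subst (λ as → Q (exec P (sem f as , vs))) (nullary-args e (selectᵃ vs xs)) h
    go (i ∷ is) e = h

  Inp : Store → Set
  Inp Γ = (x : Fin k) → τ x ∈ Γ

  envOf : ∀ {Γ} → Args Γ → Inp Γ → Env k τ
  envOf vs inp x = lookupᵃ vs (inp x)

  Cont : (Store → Set) → Store → Set
  Cont R Γ = ∀ {Γ'} → Γ' ⊒ Γ → R Γ' → Prog Γ'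

  mutual
    compile : ∀ {Γ i} → Good k τ i → Inp Γ → Cont (i ∈_) Γ → Prog Γ
    compile (gapp f ts) inp κ = compileArgs ts inp (λ e xs → instr f xs (κ (⊒-push ⊒-refl ∘⊒ e) (here refl)))

    compileArgs : ∀ {Γ is} → GArgs k τ is → Inp Γ → Cont (λ Γ' → All (_∈ Γ') is) Γ → Prog Γ
    compileArgs [] inp κ = κ ⊒-refl []
    compileArgs (x ∷v ts) inp κ = compileArgs ts inp (λ e xs → κ e (wk e (inp x) ∷ xs))
    compileArgs (t ∷g ts) inp κ =
      compile t inp (λ e x → compileArgs ts (wk e ∘ inp) (λ e' xs → κ (e' ∘⊒ e) (wk e' x ∷ xs)))

  mutual
    compile-exec : ∀ {Γ i} (t : Good k τ i) (inp : Inp Γ) (κ : Cont (i ∈_) Γ) (vs : Args Γ) (Q : Post) →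
      (∀ {Γ'} (e : Γ' ⊒ Γ) x (vs' : Args Γ') → Extends e vs' vs →
         lookupᵃ vs' x ≡ ⟦ t ⟧ (envOf vs inp) → Q (exec (κ e x) vs')) →
      Q (exec (compile t inp κ) vs)
    compile-exec (gapp f ts) inp κ vs Q H =
      compileArgs-exec ts inp _ vs Q (λ e xs vs' ext eq →
        exec-instr f xs _ vs' Q
          (H (⊒-push ⊒-refl ∘⊒ e) (here refl) (sem f (selectᵃ vs' xs) , vs')
             (Extends-∘ {e' = ⊒-push ⊒-refl} {e} (Extends-push (sem f (selectᵃ vs' xs)) vs') ext) (cong (sem f) eq)))

    compileArgs-exec : ∀ {Γ is} (ts : GArgs k τ is) (inp : Inp Γ) (κ : Cont (λ Γ' → All (_∈ Γ') is) Γ)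
      (vs : Args Γ) (Q : Post) →
      (∀ {Γ'} (e : Γ' ⊒ Γ) xs (vs' : Args Γ') → Extends e vs' vs →
         selectᵃ vs' xs ≡ ⟦ ts ⟧ₐ (envOf vs inp) → Q (exec (κ e xs) vs')) →
      Q (exec (compileArgs ts inp κ) vs)
    compileArgs-exec [] inp κ vs Q H = H ⊒-refl [] vs (Extends-refl vs) refl
    compileArgs-exec (x ∷v ts) inp κ vs Q H =
      compileArgs-exec ts inp _ vs Q (λ e xs vs' ext eq →
        H e (wk e (inp x) ∷ xs) vs' ext (cong₂ _,_ (lookup-wk ext (inp x)) eq))
    compileArgs-exec (t ∷g ts) inp κ vs Q H =
      compile-exec t inp _ vs Q (λ e x vs' ext eqx →
        compileArgs-exec ts (wk e ∘ inp) _ vs' Q (λ e' xs vs'' ext' eqxs →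
          H (e' ∘⊒ e) (wk e' x ∷ xs) vs'' (Extends-∘ {e' = e'} {e} ext' ext)
            (cong₂ _,_ (trans (lookup-wk ext' x) eqx) (trans eqxs (⟦⟧ₐ-cong ts (lookup-wk ext ∘ inp))))))

  compileAll : ∀ {Γ} m (ty : Fin m → Fin n) (ts : (t : Fin m) → Good k τ (ty t)) → Inp Γ →
               Cont (λ Γ' → (t : Fin m) → ty t ∈ Γ') Γ → Prog Γ
  compileAll zero ty ts inp κ = κ ⊒-refl (λ ())
  compileAll (suc m) ty ts inp κ =
    compile (ts fz) inp (λ e x → compileAll m (ty ∘ fs) (ts ∘ fs) (wk e ∘ inp)
      (λ e' xs → κ (e' ∘⊒ e) (λ { fz → wk e' x ; (fs t) → xs t })))

  compileAll-exec : ∀ {Γ} m (ty : Fin m → Fin n) (ts : (t : Fin m) → Good k τ (ty t)) (inp : Inp Γ)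
    (κ : Cont (λ Γ' → (t : Fin m) → ty t ∈ Γ') Γ) (vs : Args Γ) (Q : Post) →
    (∀ {Γ'} (e : Γ' ⊒ Γ) xs (vs' : Args Γ') → Extends e vs' vs →
       (∀ t → lookupᵃ vs' (xs t) ≡ ⟦ ts t ⟧ (envOf vs inp)) → Q (exec (κ e xs) vs')) →
    Q (exec (compileAll m ty ts inp κ) vs)
  compileAll-exec zero ty ts inp κ vs Q H = H ⊒-refl (λ ()) vs (Extends-refl vs) (λ ())
  compileAll-exec (suc m) ty ts inp κ vs Q H =
    compile-exec (ts fz) inp _ vs Q (λ e x vs' ext eqx →
      compileAll-exec m (ty ∘ fs) (ts ∘ fs) (wk e ∘ inp) _ vs' Q (λ e' xs vs'' ext' eqxs →
        H (e' ∘⊒ e) _ vs'' (Extends-∘ {e' = e'} {e} ext' ext)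
          (λ { fz → trans (lookup-wk ext' x) eqx
             ; (fs t) → trans (eqxs t) (⟦⟧-cong (ts (fs t)) (lookup-wk ext ∘ inp)) })))

  compileAll² : ∀ {Γ} p (ts : Fin p → (j : Fin k) → Good k τ (τ j)) → Inp Γ →
                Cont (λ Γ' → (s : Fin p) (j : Fin k) → τ j ∈ Γ') Γ → Prog Γ
  compileAll² zero ts inp κ = κ ⊒-refl (λ ())
  compileAll² (suc p) ts inp κ =
    compileAll k τ (ts fz) inp (λ e x → compileAll² p (ts ∘ fs) (wk e ∘ inp)
      (λ e' xs → κ (e' ∘⊒ e) (λ { fz j → wk e' (x j) ; (fs s) j → xs s j })))

  compileAll²-exec : ∀ {Γ} p (ts : Fin p → (j : Fin k) → Good k τ (τ j)) (inp : Inp Γ)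
    (κ : Cont (λ Γ' → (s : Fin p) (j : Fin k) → τ j ∈ Γ') Γ) (vs : Args Γ) (Q : Post) →
    (∀ {Γ'} (e : Γ' ⊒ Γ) xs (vs' : Args Γ') → Extends e vs' vs →
       (∀ s j → lookupᵃ vs' (xs s j) ≡ ⟦ ts s j ⟧ (envOf vs inp)) → Q (exec (κ e xs) vs')) →
    Q (exec (compileAll² p ts inp κ) vs)
  compileAll²-exec zero ts inp κ vs Q H = H ⊒-refl (λ ()) vs (Extends-refl vs) (λ ())
  compileAll²-exec (suc p) ts inp κ vs Q H =
    compileAll-exec k τ (ts fz) inp _ vs Q (λ e x vs' ext eqx →
      compileAll²-exec p (ts ∘ fs) (wk e ∘ inp) _ vs' Q (λ e' xs vs'' ext' eqxs →
        H (e' ∘⊒ e) _ vs'' (Extends-∘ {e' = e'} {e} ext' ext)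
          (λ { fz j → trans (lookup-wk ext' (x j)) (eqx j)
             ; (fs s) j → trans (eqxs s j) (⟦⟧-cong (ts (fs s) j) (lookup-wk ext ∘ inp)) })))

module Gadgets (S : Sig) where
  open WithSig S
  open Leftmost S

  Id : Tm
  Id = ƛ var 0

  Id-Inert : Inert Id
  Id-Inert = record { closed = ƛ var (s≤s z≤n) ; fnormal = FNormal-ƛ FNormal-var ; nonConHead = λ f () }

  padβ : ℕ → Tm → Tm
  padβ zero t = t
  padβ (suc d) t = Id · padβ d t

  padβ-FNormal : ∀ d {t} → FNormal t → FNormal (padβ d t)
  padβ-FNormal zero nt = nt
  padβ-FNormal (suc d) nt = FNormal-ƛ· FNormal-var (padβ-FNormal d nt)

  padβ-Inert : ∀ d {t} → Inert t → Inert (padβ d t)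
  padβ-Inert zero it = it
  padβ-Inert (suc d) it = record
    { closed = closed Id-Inert · closed (padβ-Inert d it)
    ; fnormal = padβ-FNormal (suc d) (fnormal it)
    ; nonConHead = λ f ()
    }

  padβ-run : ∀ d {t} → FNormal t → LRed d 0 (padβ d t) t
  padβ-run zero nt = done
  padβ-run (suc d) nt = stepβ (padβ-FNormal (suc d) nt) root (padβ-run d nt)

  -- Each copy of R is the argument of an Id, so the copies are the leftmost 𝔽-redexes in turn.
  padF : ℕ → Tm → Tm
  padF zero R = Id
  padF (suc d) R = (Id · R) · padF d R

  padF-FNormal : ∀ d {R} → FNormal R → FNormal (padF d R)
  padF-FNormal zero nR = FNormal-ƛ FNormal-var
  padF-FNormal (suc d) nR = FNormal-ƛ·· FNormal-var nR (padF-FNormal d nR)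

  padF-run : ∀ d {R R'} → FRedex R R' → FNormal R' → (E : Tm → Tm) → (∀ {t t'} → t ⟶Fl t' → E t ⟶Fl E t') →
             LRed 0 d (E (padF d R)) (E (padF d R'))
  padF-run zero r nR' E E-step = done
  padF-run (suc d) {R} {R'} r nR' E E-step =
    stepF (E-step (appL (NonConHead⇒¬FRedex (λ f ())) (appR ¬FRedex-ƛ· (FNormal-ƛ FNormal-var) (root r))))
      (padF-run d r nR' (λ t → E (((Id · R') · t)))
        (λ s → E-step (appR (NonConHead⇒¬FRedex (λ f ())) (FNormal-ƛ· FNormal-var nR') s)))

  second : Tm
  second = ƛ ƛ var 0

  second-Inert : Inert second
  second-Inert = record { closed = ƛ ƛ var (s≤s z≤n) ; fnormal = FNormal-ƛ (FNormal-ƛ FNormal-var) ; nonConHead = λ f () }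

  second-run : ∀ t u → FNormal t → FNormal u → LRed 2 0 ((second · t) · u) u
  second-run t u nt nu =
    stepβ (FNormal-ƛ·· (FNormal-ƛ FNormal-var) nt nu) (appL (λ ()) root)
      (stepβ (FNormal-ƛ· FNormal-var nu) root done)

  cases : ∀ N → (Fin N → Tm) → (Fin N → Tm) → Tm → Tm
  cases zero B X d = d
  cases (suc N) B X d = (B fz · X fz) · cases N (B ∘ fs) (X ∘ fs) d

  casesCost : ℕ → ℕ
  casesCost zero = 2
  casesCost (suc s) = 2 + casesCost s

  casesCost≡ : ∀ s → casesCost s ≡ 2 * suc s
  casesCost≡ zero = refl
  casesCost≡ (suc s) = trans (cong (2 +_) (casesCost≡ s)) (sym (*-suc 2 (suc s)))

  cases-FNormal : ∀ N B X d → (∀ t → Inert (B t)) → (∀ t → Inert (X t)) → Inert d → FNormal (cases N B X d)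
  cases-FNormal zero B X d iB iX id = fnormal id
  cases-FNormal (suc N) B X d iB iX id =
    FNormal-· (FNormal-· (fnormal (iB fz)) (fnormal (iX fz)) (NonConHead⇒¬FRedex (nonConHead (iB fz))))
              (cases-FNormal N _ _ d (iB ∘ fs) (iX ∘ fs) id)
              (NonConHead⇒¬FRedex (nonConHead (iB fz)))

  ⌜True⌝ ⌜False⌝ : Tm
  ⌜True⌝ = ƛ ƛ var 1
  ⌜False⌝ = ƛ ƛ var 0

  cases-run : ∀ N B X d (s : Fin N) → (∀ t → Inert (B t)) → (∀ t → Inert (X t)) → Inert d →
              B s ≡ ⌜True⌝ → (∀ t → t <ᶠ s → B t ≡ ⌜False⌝) → LRed (casesCost (toℕ s)) 0 (cases N B X d) (X s)
  cases-run (suc N) B X d fz iB iX id eT _ with B fz | eT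
  ... | _ | refl =
    stepβ (FNormal-ƛ·· (FNormal-ƛ FNormal-var) (fnormal (iX fz)) rest) (appL (λ ()) root)
      (stepβ (FNormal-ƛ· (subst FNormal (sym shifted) (fnormal (iX fz))) rest) root
        (LRed-cast refl refl selected done))
    where
    rest : FNormal (cases N (B ∘ fs) (X ∘ fs) d)
    rest = cases-FNormal N _ _ d (iB ∘ fs) (iX ∘ fs) id
    shifted : shift 0 (X fz) ≡ X fz
    shifted = shift-scoped (closed (iX fz))
    selected : sub 0 (cases N (B ∘ fs) (X ∘ fs) d) (shift 0 (X fz)) ≡ X fz
    selected = trans (cong (sub 0 _) shifted) (sub-scoped _ (closed (iX fz)))
  cases-run (suc N) B X d (fs s) iB iX id eT eF with B fz | eF fz (s≤s z≤n)
  ... | _ | refl =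
    stepβ (FNormal-ƛ·· (FNormal-ƛ FNormal-var) (fnormal (iX fz)) rest) (appL (λ ()) root)
      (stepβ (FNormal-ƛ· FNormal-var rest) root
        (cases-run N _ _ d s (iB ∘ fs) (iX ∘ fs) id eT (λ t lt → eF (fs t) (s≤s lt))))
    where
    rest : FNormal (cases N (B ∘ fs) (X ∘ fs) d)
    rest = cases-FNormal N _ _ d (iB ∘ fs) (iX ∘ fs) id

-- Every combinator receives the self-applicable term W first and then the store, most recent
-- entry first.
module Compiled (S : Sig) (k : ℕ) (τ : Fin k → Fin (Sig.n S)) (N : ℕ) (pad : Fin N → ℕ) where
  open WithSig S
  open Leftmost S
  open Combinators S
  open Stores S
  open Gadgets S
  open Programs S k τ N

  storeT : ℕ → List Tpl
  storeT g = map par (countFrom 1 g)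

  padβT : ℕ → Tpl → Tpl
  padβT zero T = T
  padβT (suc d) T = cst Id $ padβT d T

  envT : ∀ {Γ : Store} {k'} {τ' : Fin k' → Fin n} → ((j : Fin k') → τ' j ∈ Γ) → List Tpl
  envT {k' = zero} xs = []
  envT {k' = suc k'} xs = par (suc (pos (xs fz))) ∷ envT (xs ∘ fs)

  outT : ∀ {Γ} → Out Γ → Tpl
  outT (recurse xs) = (par 0 $ par 0) $⋆ envT xs
  outT (return i x) = par (suc (pos x))

  casesT : ∀ {Γ} M → (Fin M → bool ∈ Γ) → (Fin M → Out Γ) → (Fin M → ℕ) → Tpl
  casesT zero b o d = cst Id
  casesT (suc M) b o d = (par (suc (pos (b fz))) $ padβT (d fz) (outT (o fz))) $ casesT M (b ∘ fs) (o ∘ fs) (d ∘ fs)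

  konstT : ℕ → Tm → Tm → Tpl
  konstT g next c = cst next $⋆ (par 0 ∷ cst c ∷ storeT g)

  moveT : ∀ {Γ : Store} {is} → Tm → All (_∈ Γ) is → Tpl
  moveT {Γ} callee xs = cst callee $⋆ (par 0 ∷ (storeT (length Γ) ++ map (λ i → par (suc i)) (All.reduce pos xs)))

  -- The arguments of f are the r+1 parameters after W and the g store entries.
  callT : ℕ → Fsym → ℕ → Tm → Tpl
  callT g f r next = cst next $⋆ (par 0 ∷ capp f (countFrom (suc g) r) (suc g + r) ∷ storeT g)

  storeT-Safe : ∀ g {m} → suc g ≤ m → All (Safe m) (storeT g)
  storeT-Safe g le = map⁺ (All.map par (All-countFrom 1 g le (λ i<m → i<m)))

  konstT-Safe : ∀ g {next c} → Inert next → Inert c → Safe (suc g) (konstT g next c)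
  konstT-Safe g inext ic = Safe-$⋆ (cst _) _ tt (cst inext) (par (s≤s z≤n) ∷ cst ic ∷ storeT-Safe g ≤-refl)

  moveT-Safe : ∀ {Γ is callee} (xs : All (_∈ Γ) is) → Inert callee → Safe (suc (length Γ)) (moveT callee xs)
  moveT-Safe {Γ} xs icallee = Safe-$⋆ (cst _) _ tt (cst icallee)
    (par (s≤s z≤n) ∷ ++⁺ (storeT-Safe (length Γ) ≤-refl) (map⁺ (All.map (λ i<g → par (s≤s i<g)) (pos-<-all xs))))

  callT-Safe : ∀ g f r {next} → length (dom f) ≡ suc r → Inert next → Safe (suc g + suc r) (callT g f r next)
  callT-Safe g f r e inext = Safe-$⋆ (cst _) _ tt (cst inext)
    (par (s≤s z≤n)
      ∷ capp (All-countFrom (suc g) r (+-monoʳ-≤ (suc g) (n≤1+n r)) (λ i<m → i<m))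
             (trans (cong suc (length-countFrom (suc g) r)) (sym e)) (sym (+-suc (suc g) r))
      ∷ storeT-Safe g (m≤m+n (suc g) (suc r)))

  padβT-Safe : ∀ {m} d {T} → Safe m T → Safe m (padβT d T)
  padβT-Safe zero sT = sT
  padβT-Safe (suc d) sT = app tt (cst Id-Inert) (padβT-Safe d sT)

  envT-Safe : ∀ {Γ : Store} {k'} {τ' : Fin k' → Fin n} (xs : (j : Fin k') → τ' j ∈ Γ) →
              All (Safe (suc (length Γ))) (envT xs)
  envT-Safe {k' = zero} xs = []
  envT-Safe {k' = suc k'} xs = par (s≤s (pos-< (xs fz))) ∷ envT-Safe (xs ∘ fs)

  outT-Safe : ∀ {Γ} (o : Out Γ) → Safe (suc (length Γ)) (outT o)
  outT-Safe (recurse xs) = Safe-$⋆ (par 0 $ par 0) (envT xs) tt (app tt (par (s≤s z≤n)) (par (s≤s z≤n))) (envT-Safe xs)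
  outT-Safe (return i x) = par (s≤s (pos-< x))

  casesT-Safe : ∀ {Γ} M b o d → Safe (suc (length Γ)) (casesT {Γ} M b o d)
  casesT-Safe zero b o d = cst Id-Inert
  casesT-Safe (suc M) b o d =
    app tt (app tt (par (s≤s (pos-< (b fz)))) (padβT-Safe (d fz) (outT-Safe (o fz)))) (casesT-Safe M _ _ _)

  combP : ∀ {Γ} → Prog Γ → Tm
  combP {Γ} (konst f e P) = comb (suc (length Γ)) (konstT (length Γ) (combP P) (code (cod f) (konstVal f e)))
  combP {Γ} (call f r e xs P) =
    comb (suc (length Γ)) (moveT (comb (suc (length Γ) + suc r) (callT (length Γ) f r (combP P))) xs)
  combP {Γ} (halt b o) = comb (suc (length Γ)) (casesT N b o pad)

  combP-Inert : ∀ {Γ} (P : Prog Γ) → Inert (combP P)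
  combP-Inert {Γ} (konst f e P) = comb-Inert _ _ (s≤s z≤n) (konstT-Safe (length Γ) (combP-Inert P) (code-Inert _ _))
  combP-Inert {Γ} (call f r e xs P) =
    comb-Inert _ _ (s≤s z≤n) (moveT-Safe xs (comb-Inert _ _ (s≤s z≤n) (callT-Safe (length Γ) f r e (combP-Inert P))))
  combP-Inert {Γ} (halt b o) = comb-Inert _ _ (s≤s z≤n) (casesT-Safe N b o pad)

  module Run (W : Tm) (iW : Inert W) where

    σ[_] : List Tm → ℕ → Tm
    σ[ us ] = (W ∷ us) ‼_

    haltTm : Halted → Tm
    haltTm (halted b o vs) = inst σ[ codes vs ] (casesT N b o pad)

    inst-storeT : ∀ us vs {g} → length us ≡ g → map (inst σ[ us ++ vs ]) (storeT g) ≡ us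
    inst-storeT us vs refl =
      trans (sym (map-∘ (countFrom 1 (length us)))) (trans (map-‼-∷ W (us ++ vs) 0 (length us)) (map-‼-++ˡ us vs))

    inst-storeT-all : ∀ us {g} → length us ≡ g → map (inst σ[ us ]) (storeT g) ≡ us
    inst-storeT-all us refl =
      trans (sym (map-∘ (countFrom 1 (length us)))) (trans (map-‼-∷ W us 0 (length us)) (map-‼-countFrom us refl))

    inst-capp : ∀ us vs g r f → length us ≡ g → length vs ≡ suc r →
      (con f ·⋆ map σ[ us ++ vs ] (countFrom (suc g) r)) · σ[ us ++ vs ] (suc g + r) ≡ con f ·⋆ vs
    inst-capp us vs g r f refl lvs = begin
      (con f ·⋆ map σ[ us ++ vs ] (countFrom (suc (length us)) r)) · σ[ us ++ vs ] (suc (length us) + r)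
        ≡⟨ cong₂ (λ ts t → (con f ·⋆ ts) · t)
                 (trans (map-‼-∷ W (us ++ vs) (length us) r) first-args) (‼-++ʳ us vs r) ⟩
      (con f ·⋆ map (vs ‼_) (countFrom 0 r)) · vs ‼ r
        ≡⟨ sym (·⋆-∷ʳ (con f) (map (vs ‼_) (countFrom 0 r)) (vs ‼ r)) ⟩
      con f ·⋆ (map (vs ‼_) (countFrom 0 r) ∷ʳ vs ‼ r)   ≡⟨ cong (con f ·⋆_) all-args ⟩
      con f ·⋆ vs                                        ∎
      where
      open ≡-Reasoning
      first-args : map ((us ++ vs) ‼_) (countFrom (length us) r) ≡ map (vs ‼_) (countFrom 0 r)
      first-args = subst (λ a → map ((us ++ vs) ‼_) (countFrom a r) ≡ _) (+-identityʳ (length us)) (map-‼-++ʳ us vs 0 r)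
      all-args : map (vs ‼_) (countFrom 0 r) ∷ʳ vs ‼ r ≡ vs
      all-args = trans (sym (map-++ (vs ‼_) (countFrom 0 r) (r ∷ [])))
                   (trans (cong (map (vs ‼_)) (sym (countFrom-suc 0 r))) (map-‼-countFrom vs lvs))

    -- The applied constant sits in argument position behind the inert `next W`, so it is the
    -- leftmost 𝔽-redex.
    call-step : ∀ {next R R' : Tm} us → Inert next → FRedex R R' →
                LRed 0 1 (((next · W) · R) ·⋆ us) (((next · W) · R') ·⋆ us)
    call-step us inext r =
      stepF (⟶Fl-·⋆ us (appR (NonConHead⇒¬FRedex (nonConHead inext))
                              (FNormal-· (fnormal inext) (fnormal iW) (NonConHead⇒¬FRedex (nonConHead inext)))
                              (root r))
                        (nonConHead inext))
            done

    combP-run : ∀ {Γ} (P : Prog Γ) (vs : Args Γ) → LRed (costβ P) (costF P) (combP P ·⋆ (W ∷ codes vs)) (haltTm (exec P vs))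
    combP-run {Γ} (konst f e P) vs =
      LRed-trans
        (LRed-cast refl refl pushed (comb-run (suc (length Γ)) _ (W ∷ codes vs) (cong suc (length-codes vs))
           (konstT-Safe (length Γ) (combP-Inert P) (code-Inert _ _)) (iW ∷ codes-Inert vs)))
        (combP-run P (konstVal f e , vs))
      where
      c : Tm
      c = code (cod f) (konstVal f e)
      pushed : inst σ[ codes vs ] (konstT (length Γ) (combP P) c) ≡ combP P ·⋆ (W ∷ c ∷ codes vs)
      pushed = trans (inst-$⋆ σ[ codes vs ] (cst (combP P)) (par 0 ∷ cst c ∷ storeT (length Γ)))
                     (cong (λ us → combP P ·⋆ (W ∷ c ∷ us)) (inst-storeT-all (codes vs) (length-codes vs)))
    combP-run {Γ} (call f r e xs P) vs =
      LRed-trans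
        (LRed-cast refl refl moved (comb-run (suc (length Γ)) _ (W ∷ codes vs) (cong suc (length-codes vs))
           (moveT-Safe xs icallee) (iW ∷ codes-Inert vs)))
        (LRed-trans
          (LRed-cast refl refl called (comb-run (suc (length Γ) + suc r) _ (W ∷ (codes vs ++ codes as)) length-args
             (callT-Safe (length Γ) f r e (combP-Inert P)) (iW ∷ ++⁺ (codes-Inert vs) (codes-Inert as))))
          (LRed-trans (call-step (codes vs) (combP-Inert P) (f , as , applied , refl))
            (combP-run P (sem f as , vs))))
      where
      as : Args (dom f)
      as = selectᵃ vs xs
      callee : Tm
      callee = comb (suc (length Γ) + suc r) (callT (length Γ) f r (combP P))
      icallee : Inert callee
      icallee = comb-Inert _ _ (s≤s z≤n) (callT-Safe (length Γ) f r e (combP-Inert P))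
      σ′ : ℕ → Tm
      σ′ = σ[ codes vs ++ codes as ]
      length-args : length (W ∷ (codes vs ++ codes as)) ≡ suc (length Γ) + suc r
      length-args = cong suc (trans (length-++ (codes vs)) (cong₂ _+_ (length-codes vs) (trans (length-codes as) e)))
      moved : inst σ[ codes vs ] (moveT callee xs) ≡ callee ·⋆ (W ∷ (codes vs ++ codes as))
      moved = trans (inst-$⋆ σ[ codes vs ] (cst callee)
                              (par 0 ∷ (storeT (length Γ) ++ map (λ i → par (suc i)) (All.reduce pos xs))))
                (cong (λ us → callee ·⋆ (W ∷ us))
                  (trans (map-++ (inst σ[ codes vs ]) (storeT (length Γ)) _)
                    (cong₂ _++_ (inst-storeT-all (codes vs) (length-codes vs))
                                (trans (sym (map-∘ (All.reduce pos xs))) (‼-codes-select vs xs)))))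
      R : Tm
      R = (con f ·⋆ map σ′ (countFrom (suc (length Γ)) r)) · σ′ (suc (length Γ) + r)
      applied : R ≡ con f ·⋆ codes as
      applied = inst-capp (codes vs) (codes as) (length Γ) r f (length-codes vs) (trans (length-codes as) e)
      called : inst σ′ (callT (length Γ) f r (combP P)) ≡ ((combP P · W) · R) ·⋆ codes vs
      called = trans (inst-$⋆ σ′ (cst (combP P))
                               (par 0 ∷ capp f (countFrom (suc (length Γ)) r) (suc (length Γ) + r) ∷ storeT (length Γ)))
                     (cong (((combP P · W) · R) ·⋆_) (inst-storeT (codes vs) (codes as) (length-codes vs)))
    combP-run {Γ} (halt b o) vs =
      comb-run (suc (length Γ)) _ (W ∷ codes vs) (cong suc (length-codes vs)) (casesT-Safe N b o pad) (iW ∷ codes-Inert vs)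

    inst-padβT : ∀ σ d T → inst σ (padβT d T) ≡ padβ d (inst σ T)
    inst-padβT σ zero T = refl
    inst-padβT σ (suc d) T = cong (Id ·_) (inst-padβT σ d T)

    inst-envT : ∀ {Γ k'} {τ' : Fin k' → Fin n} (vs : Args Γ) (xs : (j : Fin k') → τ' j ∈ Γ) →
                map (inst σ[ codes vs ]) (envT xs) ≡ codes (envArgs (lookupᵃ vs ∘ xs))
    inst-envT {k' = zero} vs xs = refl
    inst-envT {k' = suc k'} vs xs = cong₂ _∷_ (‼-codes vs (xs fz)) (inst-envT vs (xs ∘ fs))

    inst-recurse : ∀ {Γ} (vs : Args Γ) xs →
                   inst σ[ codes vs ] (outT (recurse xs)) ≡ (W · W) ·⋆ codes (envArgs (lookupᵃ vs ∘ xs))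
    inst-recurse vs xs = trans (inst-$⋆ _ (par 0 $ par 0) (envT xs)) (cong ((W · W) ·⋆_) (inst-envT vs xs))

    WW-Inert : Inert (W · W)
    WW-Inert = record
      { closed = closed iW · closed iW
      ; fnormal = FNormal-· (fnormal iW) (fnormal iW) (NonConHead⇒¬FRedex (nonConHead iW))
      ; nonConHead = nonConHead iW
      }

    outT-Inert : ∀ {Γ} (o : Out Γ) (vs : Args Γ) → Inert (inst σ[ codes vs ] (outT o))
    outT-Inert (recurse xs) vs =
      subst Inert (sym (inst-recurse vs xs)) (Inert-·⋆ (W · W) _ WW-Inert (codes-Inert (envArgs (lookupᵃ vs ∘ xs))))
    outT-Inert (return i x) vs = subst Inert (sym (‼-codes vs x)) (code-Inert _ _)

    inst-casesT : ∀ {Γ} M (b : Fin M → bool ∈ Γ) o d (vs : Args Γ) →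
      inst σ[ codes vs ] (casesT M b o d) ≡
      cases M (λ t → code bool (lookupᵃ vs (b t))) (λ t → padβ (d t) (inst σ[ codes vs ] (outT (o t)))) Id
    inst-casesT zero b o d vs = refl
    inst-casesT (suc M) b o d vs =
      cong₂ _·_ (cong₂ _·_ (‼-codes vs (b fz)) (inst-padβT _ (d fz) (outT (o fz)))) (inst-casesT M _ _ _ vs)

module Theta (S : Sig) where
  open WithSig S
  open Leftmost S
  open Semantics S
  open Combinators S
  open Stores S
  open Gadgets S

  module Construction
    (ω : Fsym) (r : ℕ) (ω-arity : length (dom ω) ≡ suc r) (ν : Args (dom ω))
    (k p q : ℕ) (τ : Fin k → Fin n) (ι : Fin q → Fin n) (ρ : Fin (p + q) → Good k τ bool)
    (φ : Fin p → (j : Fin k) → Good k τ (τ j)) (γ : (l : Fin q) → Good k τ (ι l)) where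

    N : ℕ
    N = p + q

    open Programs S k τ N

    outputs : ∀ {Γ₂ Γ₃} → Γ₃ ⊒ Γ₂ → ((s : Fin p) (j : Fin k) → τ j ∈ Γ₂) → ((l : Fin q) → ι l ∈ Γ₃) →
              Fin N → Out Γ₃
    outputs e xφ xγ t = [ (λ s → recurse (wk e ∘ xφ s)) , (λ l → return (ι l) (xγ l)) ]′ (splitAt p t)

    program : Prog (tabulate τ)
    program =
      compileAll N (λ _ → bool) ρ ∈-tabulate⁺ λ e₁ xρ →
      compileAll² p φ (wk e₁ ∘ ∈-tabulate⁺) λ e₂ xφ →
      compileAll q ι γ (wk e₂ ∘ wk e₁ ∘ ∈-tabulate⁺) λ e₃ xγ →
      halt (wk e₃ ∘ wk e₂ ∘ xρ) (outputs e₃ xφ xγ)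

    record Correct (a : Env k τ) (h : Halted) : Set where
      open Halted h
      field
        tests-ok   : ∀ t → lookupᵃ values (tests t) ≡ ⟦ ρ t ⟧ a
        recurse-ok : ∀ s → Σ ((j : Fin k) → τ j ∈ store) λ xs →
                       outs (s ↑ˡ q) ≡ recurse xs × (∀ j → lookupᵃ values (xs j) ≡ ⟦ φ s j ⟧ a)
        return-ok  : ∀ l → Σ (ι l ∈ store) λ x → outs (p ↑ʳ l) ≡ return (ι l) x × lookupᵃ values x ≡ ⟦ γ l ⟧ a

    program-correct : ∀ a → Correct a (exec program (envArgs a))
    program-correct a =
      compileAll-exec N (λ _ → bool) ρ ∈-tabulate⁺ _ (envArgs a) (Correct a) λ e₁ xρ vs₁ ext₁ eqρ →
      compileAll²-exec p φ _ _ vs₁ (Correct a) λ e₂ xφ vs₂ ext₂ eqφ →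
      compileAll-exec q ι γ _ _ vs₂ (Correct a) λ e₃ xγ vs₃ ext₃ eqγ →
      record
        { tests-ok = λ t →
            trans (lookup-wk ext₃ (wk e₂ (xρ t))) (trans (lookup-wk ext₂ (xρ t)) (trans (eqρ t) (⟦⟧-cong (ρ t) envOf₀)))
        ; recurse-ok = λ s → wk e₃ ∘ xφ s , cong [ _ , _ ]′ (splitAt-↑ˡ p s q) ,
            λ j → trans (lookup-wk ext₃ (xφ s j))
                        (trans (eqφ s j) (⟦⟧-cong (φ s j) (λ x → trans (lookup-wk ext₁ _) (envOf₀ x))))
        ; return-ok = λ l → xγ l , cong [ _ , _ ]′ (splitAt-↑ʳ p q l) ,
            trans (eqγ l) (⟦⟧-cong (γ l) (λ x → trans (lookup-wk ext₂ _) (trans (lookup-wk ext₁ _) (envOf₀ x))))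
        }
      where
      envOf₀ : ∀ x → envOf (envArgs a) ∈-tabulate⁺ x ≡ a x
      envOf₀ = lookup-envArgs a

    mP : ℕ
    mP = suc k + suc r

    -- W W a⃗ (k+1 β-steps), then `setup` (mP), discarding the 𝔽-padding (2), then the program.
    prefixβ : ℕ
    prefixβ = suc k + (mP + (2 + costβ program))

    Kmin Lmin : ℕ
    Kmin = prefixβ + 2 * N
    Lmin = costF program

    module Padded (K L : ℕ) (Kmin≤K : Kmin ≤ K) (Lmin≤L : Lmin ≤ L) where

      extraβ extraF : ℕ
      extraβ = K ∸ Kmin
      extraF = L ∸ Lmin

      -- Branch t costs casesCost t β-steps; the padding equalises all branches to 2N + extraβ.
      pad : Fin N → ℕ
      pad t = 2 * (N ∸ suc (toℕ t)) + extraβ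

      open Compiled S k τ N pad

      R R' : Tm
      R = con ω ·⋆ codes ν
      R' = code (cod ω) (sem ω ν)

      padFT : ℕ → Tpl
      padFT zero = cst Id
      padFT (suc d) = (cst Id $ capp ω (countFrom (suc k) r) (suc k + r)) $ padFT d

      padFT-Safe : ∀ d → Safe mP (padFT d)
      padFT-Safe zero = cst Id-Inert
      padFT-Safe (suc d) =
        app tt (app tt (cst Id-Inert)
          (capp (All-countFrom (suc k) r (+-monoʳ-≤ (suc k) (n≤1+n r)) (λ i<m → i<m))
                (trans (cong suc (length-countFrom (suc k) r)) (sym ω-arity)) (sym (+-suc (suc k) r))))
          (padFT-Safe d)

      setupT : Tpl
      setupT = (cst second $ padFT extraF) $ (cst (combP program) $⋆ (par 0 ∷ storeT k))

      setupT-Safe : Safe mP setupT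
      setupT-Safe = app tt (app tt (cst second-Inert) (padFT-Safe extraF))
        (Safe-$⋆ (cst (combP program)) _ tt (cst (combP-Inert program)) (par (s≤s z≤n) ∷ storeT-Safe k (m≤m+n (suc k) (suc r))))

      setup : Tm
      setup = comb mP setupT

      -- A combinator cannot contain the redex c_ω ⌜ν⌝ itself, so the codes of ν are passed to
      -- `setup` as arguments and the copies of the redex appear only at its last β-step.
      entryT : Tpl
      entryT = cst setup $⋆ (par 0 ∷ (storeT k ++ map cst (codes ν)))

      entryT-Safe : Safe (suc k) entryT
      entryT-Safe = Safe-$⋆ (cst setup) _ tt (cst (comb-Inert mP setupT (s≤s z≤n) setupT-Safe))
        (par (s≤s z≤n) ∷ ++⁺ (storeT-Safe k ≤-refl) (map⁺ (All.map cst (codes-Inert ν))))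

      W : Tm
      W = comb (suc k) entryT

      W-Inert : Inert W
      W-Inert = comb-Inert (suc k) entryT (s≤s z≤n) entryT-Safe

      θ : Tm
      θ = W · W

      open Run W W-Inert

      θ-closed : Closed θ
      θ-closed = closed WW-Inert

      enter : ∀ cs → length cs ≡ k → All Inert cs → LRed (suc k) 0 (θ ·⋆ cs) (setup ·⋆ (W ∷ (cs ++ codes ν)))
      enter cs length-cs ics =
        LRed-cast refl refl entered (comb-run (suc k) entryT (W ∷ cs) (cong suc length-cs) entryT-Safe (W-Inert ∷ ics))
        where
        entered : inst σ[ cs ] entryT ≡ setup ·⋆ (W ∷ (cs ++ codes ν))
        entered = trans (inst-$⋆ σ[ cs ] (cst setup) (par 0 ∷ (storeT k ++ map cst (codes ν))))
          (cong (λ us → setup ·⋆ (W ∷ us)) (trans (map-++ (inst σ[ cs ]) (storeT k) (map cst (codes ν)))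
            (cong₂ _++_ (inst-storeT-all cs length-cs) (trans (sym (map-∘ (codes ν))) (map-id (codes ν))))))

      setup-run : ∀ cs → length cs ≡ k → All Inert cs →
                  LRed mP 0 (setup ·⋆ (W ∷ (cs ++ codes ν))) ((second · padF extraF R) · (combP program ·⋆ (W ∷ cs)))
      setup-run cs length-cs ics =
        LRed-cast refl refl set-up
          (comb-run mP setupT (W ∷ (cs ++ codes ν)) length-args setupT-Safe (W-Inert ∷ ++⁺ ics (codes-Inert ν)))
        where
        length-ν : length (codes ν) ≡ suc r
        length-ν = trans (length-codes ν) ω-arity
        length-args : length (W ∷ (cs ++ codes ν)) ≡ mP
        length-args = cong suc (trans (length-++ cs) (cong₂ _+_ length-cs length-ν))
        inst-padFT : ∀ d → inst σ[ cs ++ codes ν ] (padFT d) ≡ padF d R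
        inst-padFT zero = refl
        inst-padFT (suc d) = cong₂ (λ x y → (Id · x) · y) (inst-capp cs (codes ν) k r ω length-cs length-ν) (inst-padFT d)
        set-up : inst σ[ cs ++ codes ν ] setupT ≡ (second · padF extraF R) · (combP program ·⋆ (W ∷ cs))
        set-up = cong₂ (λ x y → (second · x) · y) (inst-padFT extraF)
          (trans (inst-$⋆ σ[ cs ++ codes ν ] (cst (combP program)) (par 0 ∷ storeT k))
                 (cong (λ us → combP program ·⋆ (W ∷ us)) (inst-storeT cs (codes ν) length-cs)))

      prefix : ∀ a → LRed prefixβ (extraF + costF program) (applyCodes θ a) (haltTm (exec program (envArgs a)))
      prefix a rewrite applyCodes-·⋆ θ a =
        LRed-trans (enter cs length-cs ics)
          (LRed-trans (setup-run cs length-cs ics)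
            (LRed-trans fire-padding (LRed-trans discard-padding (combP-run program (envArgs a)))))
        where
        cs : List Tm
        cs = codes (envArgs a)
        length-cs : length cs ≡ k
        length-cs = trans (length-codes (envArgs a)) (length-tabulate τ)
        ics : All Inert cs
        ics = codes-Inert (envArgs a)
        X : Tm
        X = combP program ·⋆ (W ∷ cs)
        fire-padding : LRed 0 extraF ((second · padF extraF R) · X) ((second · padF extraF R') · X)
        fire-padding = padF-run extraF (ω , ν , refl , refl) (Pure⇒FNormal (code-pure _ _)) (λ t → (second · t) · X)
          (λ s → appL (NonConHead⇒¬FRedex (λ f ())) (appR ¬FRedex-ƛ· (FNormal-ƛ (FNormal-ƛ FNormal-var)) s))
        discard-padding : LRed 2 0 ((second · padF extraF R') · X) X
        discard-padding = second-run _ X (padF-FNormal extraF (Pure⇒FNormal (code-pure _ _)))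
          (fnormal (Inert-·⋆ (combP program) (W ∷ cs) (combP-Inert program) (W-Inert ∷ ics)))

      outTm : Halted → Fin N → Tm
      outTm (halted b o vs) t = inst σ[ codes vs ] (outT (o t))

      code-toBool : ∀ v b → toBool v ≡ b → code bool v ≡ code bool (subst (λ X → X) (sym A-bool) b)
      code-toBool v b e = cong (code bool) (trans (sym (subst-sym-subst A-bool)) (cong (subst (λ X → X) (sym A-bool)) e))

      branch : ∀ {a} h → Correct a h → (t : Fin N) → toBool (⟦ ρ t ⟧ a) ≡ true →
               (∀ t' → t' <ᶠ t → toBool (⟦ ρ t' ⟧ a) ≡ false) →
               LRed (casesCost (toℕ t) + pad t) 0 (haltTm h) (outTm h t)
      branch (halted b o vs) c t isTrue isFalse =
        subst (λ u → LRed _ 0 u _) (sym (inst-casesT N b o pad vs))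
          (LRed-trans
            (cases-run N _ _ Id t (λ _ → code-Inert _ _) (λ t' → padβ-Inert (pad t') (outT-Inert (o t') vs)) Id-Inert
              (test-code t true isTrue code-true) (λ t' lt → test-code t' false (isFalse t' lt) code-false))
            (padβ-run (pad t) (fnormal (outT-Inert (o t) vs))))
        where
        test-code : ∀ t' b′ {B} → toBool (⟦ ρ t' ⟧ _) ≡ b′ → code bool (subst (λ X → X) (sym A-bool) b′) ≡ B →
                    code bool (lookupᵃ vs (b t')) ≡ B
        test-code t' b′ isB codeB = trans (cong (code bool) (Correct.tests-ok c t')) (trans (code-toBool _ b′ isB) codeB)

      branch-cost : ∀ (t : Fin N) → casesCost (toℕ t) + pad t ≡ 2 * N + extraβ
      branch-cost t = begin
        casesCost (toℕ t) + (2 * (N ∸ suc (toℕ t)) + extraβ)   ≡⟨ sym (+-assoc (casesCost (toℕ t)) _ extraβ) ⟩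
        casesCost (toℕ t) + 2 * (N ∸ suc (toℕ t)) + extraβ     ≡⟨ cong (λ c → c + 2 * (N ∸ suc (toℕ t)) + extraβ) (casesCost≡ (toℕ t)) ⟩
        2 * suc (toℕ t) + 2 * (N ∸ suc (toℕ t)) + extraβ       ≡⟨ cong (_+ extraβ) (sym (*-distribˡ-+ 2 (suc (toℕ t)) _)) ⟩
        2 * (suc (toℕ t) + (N ∸ suc (toℕ t))) + extraβ         ≡⟨ cong (λ m → 2 * m + extraβ) (m+[n∸m]≡n (toℕ<n t)) ⟩
        2 * N + extraβ                                         ∎
        where open ≡-Reasoning

      θ-run : ∀ a (t : Fin N) → toBool (⟦ ρ t ⟧ a) ≡ true → (∀ t' → t' <ᶠ t → toBool (⟦ ρ t' ⟧ a) ≡ false) →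
              LRed K L (applyCodes θ a) (outTm (exec program (envArgs a)) t)
      θ-run a t isTrue isFalse =
        LRed-cast β-steps F-steps refl
          (LRed-trans (prefix a) (branch _ (program-correct a) t isTrue isFalse))
        where
        β-steps : prefixβ + (casesCost (toℕ t) + pad t) ≡ K
        β-steps = trans (cong (prefixβ +_) (branch-cost t)) (trans (sym (+-assoc prefixβ (2 * N) extraβ)) (m+[n∸m]≡n Kmin≤K))
        F-steps : extraF + costF program + 0 ≡ L
        F-steps = trans (+-identityʳ _) (m∸n+n≡m Lmin≤L)

      θ-recurse : ∀ a (s : Fin p) → toBool (⟦ ρ (s ↑ˡ q) ⟧ a) ≡ true →
                  (∀ t → t <ᶠ (s ↑ˡ q) → toBool (⟦ ρ t ⟧ a) ≡ false) →
                  LRed K L (applyCodes θ a) (applyCodes θ (λ j → ⟦ φ s j ⟧ a))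
      θ-recurse a s isTrue isFalse = LRed-cast refl refl (recursed (program-correct a)) (θ-run a (s ↑ˡ q) isTrue isFalse)
        where
        recursed : ∀ {h} → Correct a h → outTm h (s ↑ˡ q) ≡ applyCodes θ (λ j → ⟦ φ s j ⟧ a)
        recursed {halted b o vs} c with Correct.recurse-ok c s
        ... | xs , o≡ , values≡ = begin
          inst σ[ codes vs ] (outT (o (s ↑ˡ q)))           ≡⟨ cong (inst σ[ codes vs ] ∘ outT) o≡ ⟩
          inst σ[ codes vs ] (outT (recurse xs))           ≡⟨ inst-recurse vs xs ⟩
          θ ·⋆ codes (envArgs (lookupᵃ vs ∘ xs))           ≡⟨ cong (λ e → θ ·⋆ codes e) (envArgs-cong values≡) ⟩
          θ ·⋆ codes (envArgs (λ j → ⟦ φ s j ⟧ a))         ≡⟨ sym (applyCodes-·⋆ θ (λ j → ⟦ φ s j ⟧ a)) ⟩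
          applyCodes θ (λ j → ⟦ φ s j ⟧ a)                 ∎
          where open ≡-Reasoning

      θ-return : ∀ a (l : Fin q) → toBool (⟦ ρ (p ↑ʳ l) ⟧ a) ≡ true →
                 (∀ t → t <ᶠ (p ↑ʳ l) → toBool (⟦ ρ t ⟧ a) ≡ false) →
                 LRed K L (applyCodes θ a) (code (ι l) (⟦ γ l ⟧ a))
      θ-return a l isTrue isFalse = LRed-cast refl refl (returned (program-correct a)) (θ-run a (p ↑ʳ l) isTrue isFalse)
        where
        returned : ∀ {h} → Correct a h → outTm h (p ↑ʳ l) ≡ code (ι l) (⟦ γ l ⟧ a)
        returned {halted b o vs} c with Correct.return-ok c l
        ... | x , o≡ , value≡ =
          trans (cong (inst σ[ codes vs ] ∘ outT) o≡) (trans (‼-codes vs x) (cong (code (ι l)) value≡))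

omega-redex : (S : Sig) → let open WithSig S in
  HasOmega → Σ Fsym λ ω → Σ ℕ λ r → length (dom ω) ≡ suc r × Args (dom ω)
omega-redex S (ω , (i , _) , ν) = ω , proj₁ arity , proj₂ arity , tabulateArgs (dom ω) constant
  where
  open WithSig S
  positive-length : ∀ (is : List (Fin n)) → Fin (length is) → Σ ℕ λ r → length is ≡ suc r
  positive-length (_ ∷ is) _ = length is , refl
  arity : Σ ℕ λ r → length (dom ω) ≡ suc r
  arity = positive-length (dom ω) i
  constant : (j : Fin (length (dom ω))) → A (Data.List.lookup (dom ω) j)
  constant j with ν j
  ... | c , dom≡[] , cod≡ = subst A cod≡ (sem c (subst Args (sym dom≡[]) tt))
  tabulateArgs : ∀ is → ((j : Fin (length is)) → A (Data.List.lookup is j)) → Args is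
  tabulateArgs [] as = tt
  tabulateArgs (i ∷ is) as = as fz , tabulateArgs is (as ∘ fs)

lemma4p5 : (S : Sig) → let open WithSig S in
    HasOmega →
    (k p q : ℕ) (τ : Fin k → Fin n) (ι : Fin q → Fin n)
    (ρ : Fin (p + q) → Good k τ bool)
    (φ : Fin p → (j : Fin k) → Good k τ (τ j))
    (γ : (l : Fin q) → Good k τ (ι l)) →
    Σ ℕ λ Kmin → Σ ℕ λ Lmin → (K L : ℕ) → Kmin ≤ K → Lmin ≤ L →
    Σ Tm λ θ → Closed θ ×
      ((a : Env k τ) →
        ((s : Fin p) →
          toBool (⟦ ρ (s ↑ˡ q) ⟧ a) ≡ true →
          ((t : Fin (p + q)) → t <ᶠ (s ↑ˡ q) → toBool (⟦ ρ t ⟧ a) ≡ false) →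
          LRed K L (applyCodes θ a) (applyCodes θ (λ j → ⟦ φ s j ⟧ a)))
        ×
        ((l : Fin q) →
          toBool (⟦ ρ (p ↑ʳ l) ⟧ a) ≡ true →
          ((t : Fin (p + q)) → t <ᶠ (p ↑ʳ l) → toBool (⟦ ρ t ⟧ a) ≡ false) →
          LRed K L (applyCodes θ a) (code (ι l) (⟦ γ l ⟧ a))))
lemma4p5 S hasω k p q τ ι ρ φ γ with omega-redex S hasω
... | ω , r , ω-arity , ν =
  Kmin , Lmin , λ K L Kmin≤K Lmin≤L →
    let open Padded K L Kmin≤K Lmin≤L in θ , θ-closed , λ a → θ-recurse a , θ-return a
  where open Theta.Construction S ω r ω-arity ν k p q τ ι ρ φ γ
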